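{- For every integer $n\ge1$, $$\mathrm{pk}_n(213,321)=n!+n!\sum_{k=1}^{n-1}\frac{k}{\binom{n}{k}}.$$
   Context: For a positive integer $n$, $[n]=\{1,\dots,n\}$. A function $f:[n]\to[n]$ is a parking function if for every $i\in[n]$, $|\{j\in[n]: f(j)\le i\}|\ge i$ (equivalently, in the usual car-parking process where car $i$ prefers spot $f(i)$ and takes the first free spot at or after it, all cars park). The parking permutation $\rho_f\in S_n$ is defined by: spot $i$ is occupied by car $\rho_f(i)$. A permutation $\pi\in S_n$ contains $\sigma\in S_m$ as a pattern if there exist $1\le i_1<\dots<i_m\le n$ with $\pi(i_a)<\pi(i_b)$ iff $\sigma(a)<\sigma(b)$ for all $a,b$; otherwise it avoids $\sigma$. $\mathrm{pk}_n(\sigma_1,\dots,\sigma_k)$ is the number of parking functions $f:[n]\to[n]$ with $\rho_f$ avoiding every $\sigma_i$. -}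

module Defs where

open import Data.Bool using (Bool; true; false; _∧_; _∨_; not; if_then_else_)
open import Data.Nat using (ℕ; zero; suc; _≤ᵇ_; _<ᵇ_; _∸_)
open import Data.Nat using (_!)
open import Data.Nat.Combinatorics using (_C_)
open import Data.Fin using (Fin; toℕ)
open import Data.Vec using (Vec; []; _∷_; toList)
open import Data.List using (List; []; _∷_; [_]; map; concatMap; length; filterᵇ; upTo; catMaybes; replicate; zip; foldl; foldr; applyUpTo)
open import Data.Bool.ListAction using (all; any)
open import Data.Maybe using (Maybe; just; nothing)
open import Data.Product using (_×_; _,_; proj₁; proj₂)
open import Data.Integer using (+_)
open import Data.Rational using (ℚ; _/_; _+_; _*_; 0ℚ)

-- Functions f : [n] → [n] are represented as vectors  Vec (Fin n) n :
-- entry j (0-indexed) is f(j+1) - 1.  All spots/cars are 0-indexed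
-- internally (a uniform shift by one, which changes nothing below).

allFin′ : (n : ℕ) → List (Fin n)
allFin′ n = Data.List.allFin n

allVecs : (k n : ℕ) → List (Vec (Fin n) k)
allVecs zero    n = [ [] ]
allVecs (suc k) n = concatMap (λ i → map (i ∷_) (allVecs k n)) (allFin′ n)

prefs : {n : ℕ} → Vec (Fin n) n → List ℕ
prefs f = map toℕ (toList f)

-- Parking function:  for every i ∈ [n],  |{ j : f(j) ≤ i }| ≥ i.
-- (0-indexed: for every i < n,  |{ j : f(j)-1 ≤ i }| ≥ i+1.)

countLe : ℕ → List ℕ → ℕ
countLe i ps = length (filterᵇ (λ p → p ≤ᵇ i) ps)

isParkingFunction : {n : ℕ} → Vec (Fin n) n → Bool
isParkingFunction {n} f = all (λ i → suc i ≤ᵇ countLe i (prefs f)) (upTo n)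

-- The street is a list of spots (0-indexed), each
-- empty (nothing) or occupied by a car (just c).

place : ℕ → ℕ → List (Maybe ℕ) → List (Maybe ℕ)
place c p       []               = []
place c zero    (nothing ∷ xs)   = just c ∷ xs
place c zero    (just d  ∷ xs)   = just d ∷ place c zero xs
place c (suc p) (x ∷ xs)         = x ∷ place c p xs

parkAll : ℕ → List ℕ → List (Maybe ℕ)
parkAll n ps = foldl (λ st cp → place (proj₁ cp) (proj₂ cp) st)
                     (replicate n nothing) (zip (upTo n) ps)

-- parking permutation ρ_f (one-line notation, values 0-indexed):
-- spot i is occupied by car ρ_f(i).  For a parking function every spot is
-- occupied, so this list has length n.
parkingPerm : {n : ℕ} → Vec (Fin n) n → List ℕ
parkingPerm {n} f = catMaybes (parkAll n (prefs f))

subseqs : {A : Set} → List A → List (List A)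
subseqs []       = [ [] ]
subseqs (x ∷ xs) = let r = subseqs xs in map (x ∷_) r Data.List.++ r

_==ᵇ_ : Bool → Bool → Bool
true  ==ᵇ b = b
false ==ᵇ b = not b

orderIsoᵇ : List ℕ → List ℕ → Bool
orderIsoᵇ τ σ =
  (length τ Data.Nat.≡ᵇ length σ) ∧
  all (λ ab → all (λ cd → (proj₁ ab <ᵇ proj₁ cd) ==ᵇ (proj₂ ab <ᵇ proj₂ cd)) ps) ps
  where ps = zip τ σ

containsᵇ : List ℕ → List ℕ → Bool
containsᵇ π σ = any (λ τ → orderIsoᵇ τ σ) (subseqs π)

avoidsAllᵇ : List ℕ → List (List ℕ) → Bool
avoidsAllᵇ π σs = all (λ σ → not (containsᵇ π σ)) σs

pk : ℕ → List (List ℕ) → ℕ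
pk n σs = length (filterᵇ (λ f → isParkingFunction f ∧ avoidsAllᵇ (parkingPerm f) σs)
                          (allVecs n n))

fromℕℚ : ℕ → ℚ
fromℕℚ m = + m / 1

-- a / d as a rational; d = 0 never occurs below (binomials n C k with k ≤ n are ≥ 1)
fracℚ : ℕ → ℕ → ℚ
fracℚ a zero    = 0ℚ
fracℚ a (suc d) = + a / suc d

sumTerm : ℕ → ℚ
sumTerm n = foldr _+_ 0ℚ (applyUpTo (λ i → fracℚ (suc i) (n C suc i)) (n ∸ 1))

-- Let the cars park one at a time and count, for every street reached on the way, the ways of
-- finishing it. A parked car never moves and a free spot is eventually taken by a car larger than
-- all cars parked so far, so a street of the shape b … a … _ or _ … b … a with a < b, or of the
-- shape _ … b … _ … a, is doomed to contain a 213 or a 321. From the empty street, cars 0, 1, …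
-- first park in order; the first car that skips ahead, over q + 1 free spots, opens a gap. From
-- then on each car either extends the block that car started or dooms the street, and once this
-- block reaches the end of the street the remaining cars can only fill the gap from its left end.
-- The resulting permutations 0 … s−1, s+m … n−1, s … s+m−1 avoid both patterns. Multiplying the
-- numbers of forced choices gives pk_n(213, 321) = n! + Σ_{k<n} k · k! · (n − k)!, and
-- k · k! · (n − k)! = n! · k / C(n,k).

module Submission where

open import Data.Bool using (Bool; true; false; _∧_; not; T; T?)
open import Data.Bool.ListAction using (all)
open import Data.Bool.Properties using (T-≡; T-∧; T-not-≡)
open import Data.Empty using (⊥-elim)
open import Data.Fin using (Fin; toℕ)
import Data.Integer as ℤ
import Data.Integer.Properties as ℤ
open import Data.List
  using (List; []; _∷_; [_]; _++_; map; concat; foldr; foldl; length; replicate; catMaybes; filterᵇ; zip;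
         applyUpTo; upTo; tabulate; allFin)
open import Data.List.Membership.Propositional using (_∈_; find; lose)
open import Data.List.Membership.Propositional.Properties
  using (∈-upTo⁺; ∈-upTo⁻; ∈-map⁺; ∈-map⁻; ∈-++⁺ˡ; ∈-++⁺ʳ; ∈-++⁻)
open import Data.List.Properties
  using (length-replicate; length-map; length-++; ++-assoc; ++-identityʳ; catMaybes-++; map-cong; map-∘;
         map-tabulate; filter-++; filter-none; filter-≐)
open import Data.List.Relation.Binary.Sublist.Propositional using (_⊆_; []; _∷_; _∷ʳ_; ⊆-trans)
open import Data.List.Relation.Binary.Sublist.Propositional.Properties using ([]⊆-universal; ∷ˡ⁻)
import Data.List.Relation.Unary.All as All
open import Data.List.Relation.Unary.All.Properties using (all⁺; all⁻)
open import Data.List.Relation.Unary.Any using (here; there)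
open import Data.List.Relation.Unary.Any.Properties using (any⁺; any⁻)
open import Data.Maybe using (Maybe; just; nothing; is-just)
open import Data.Maybe.Properties using (just-injective)
open import Data.Nat
open import Data.Nat.Combinatorics using (_C_; nCk≡n!/k![n-k]!; k![n∸k]!∣n!)
open import Data.Nat.DivMod using (m/n*n≡m)
open import Data.Nat.ListAction using (sum)
open import Data.Nat.Properties
open import Algebra.Properties.CommutativeSemigroup +-commutativeSemigroup using () renaming (interchange to +-interchange)
open import Algebra.Properties.CommutativeSemigroup *-commutativeSemigroup using () renaming (x∙yz≈y∙xz to *-left-comm)
open import Data.Nat.Tactic.RingSolver using (solve)
open import Data.Product using (∃; ∃₂; _×_; _,_; proj₁; proj₂)
open import Data.Rational as ℚ using (ℚ; 0ℚ; fromℚᵘ)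
open import Data.Rational.Properties as ℚ
  using (toℚᵘ-injective; toℚᵘ-fromℚᵘ; toℚᵘ-homo-+; toℚᵘ-homo-*; fromℚᵘ-cong)
open import Data.Rational.Unnormalised as ℚᵘ using (mkℚᵘ; *≡*)
import Data.Rational.Unnormalised.Properties as ℚᵘ
open import Data.Sum using (_⊎_; inj₁; inj₂)
open import Data.Vec using (Vec; toList) renaming (_∷_ to _∷ᵛ_)
open import Data.Vec.Properties using (length-toList)
open import Function using (_∘_; id; Equivalence)
open import Relation.Binary.Definitions using (tri<; tri≈; tri>)
open import Relation.Binary.PropositionalEquality
  using (_≡_; _≢_; refl; sym; trans; cong; cong₂; subst; module ≡-Reasoning)
open import Relation.Nullary using (¬_; yes; no)

open import Defs

∑< : ℕ → (ℕ → ℕ) → ℕ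
∑< zero    h = 0
∑< (suc k) h = h 0 + ∑< k (h ∘ suc)

∑<-cong : ∀ k {h h′} → (∀ i → i < k → h i ≡ h′ i) → ∑< k h ≡ ∑< k h′
∑<-cong zero    eq = refl
∑<-cong (suc k) eq = cong₂ _+_ (eq 0 z<s) (∑<-cong k (λ i i<k → eq (suc i) (s<s i<k)))

∑<-mono-≤ : ∀ k {h h′} → (∀ i → i < k → h i ≤ h′ i) → ∑< k h ≤ ∑< k h′
∑<-mono-≤ zero    le = z≤n
∑<-mono-≤ (suc k) le = +-mono-≤ (le 0 z<s) (∑<-mono-≤ k (λ i i<k → le (suc i) (s<s i<k)))

∑<-const : ∀ k {h} K → (∀ i → i < k → h i ≡ K) → ∑< k h ≡ k * K
∑<-const zero    K eq = refl
∑<-const (suc k) K eq = cong₂ _+_ (eq 0 z<s) (∑<-const k K (λ i i<k → eq (suc i) (s<s i<k)))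

∑<-+ : ∀ a b h → ∑< (a + b) h ≡ ∑< a h + ∑< b (h ∘ (a +_))
∑<-+ zero    b h = refl
∑<-+ (suc a) b h = trans (cong (h 0 +_) (∑<-+ a b (h ∘ suc))) (sym (+-assoc (h 0) _ _))

∑<-suc : ∀ k h → ∑< (suc k) h ≡ ∑< k h + h k
∑<-suc zero    h = +-comm (h 0) 0
∑<-suc (suc k) h = trans (cong (h 0 +_) (∑<-suc k (h ∘ suc))) (sym (+-assoc (h 0) _ _))

∑<-increment : ∀ k {h h′} q → q < k → h′ q ≡ suc (h q) → (∀ i → i ≢ q → h′ i ≡ h i) →
               ∑< k h′ ≡ suc (∑< k h)
∑<-increment (suc k) zero    _ eq others =
  cong₂ _+_ eq (∑<-cong k (λ i _ → others (suc i) λ ()))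
∑<-increment (suc k) {h} (suc q) (s<s q<k) eq others =
  trans (cong₂ _+_ (others 0 λ ()) (∑<-increment k q q<k eq (λ i i≢q → others (suc i) (i≢q ∘ suc-injective))))
        (+-suc (h 0) _)

∑<-distrib-+ : ∀ k f g → ∑< k (λ i → f i + g i) ≡ ∑< k f + ∑< k g
∑<-distrib-+ zero    f g = refl
∑<-distrib-+ (suc k) f g = trans (cong (f 0 + g 0 +_) (∑<-distrib-+ k (f ∘ suc) (g ∘ suc)))
                                 (+-interchange (f 0) (g 0) _ _)

∑<-distribʳ-* : ∀ k f x → ∑< k f * x ≡ ∑< k (λ i → f i * x)
∑<-distribʳ-* zero    f x = refl
∑<-distribʳ-* (suc k) f x = trans (*-distribʳ-+ x (f 0) _) (cong (f 0 * x +_) (∑<-distribʳ-* k (f ∘ suc) x))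

∑<-ranges : ∀ a k b {h} K → (∀ i → i < a → h i ≡ 0) → (∀ i → i < k → h (a + i) ≡ K) →
            (∀ i → i < b → h (a + k + i) ≡ 0) → ∑< (a + k + b) h ≡ k * K
∑<-ranges a k b {h} K before inside after = begin
  ∑< (a + k + b) h                              ≡⟨ ∑<-+ (a + k) b h ⟩
  ∑< (a + k) h + ∑< b h″                        ≡⟨ cong (_+ ∑< b h″) (∑<-+ a k h) ⟩
  ∑< a h + ∑< k h′ + ∑< b h″                    ≡⟨ cong₂ (λ x y → x + ∑< k h′ + y) (∑<-const a 0 before) (∑<-const b 0 after) ⟩
  a * 0 + ∑< k h′ + b * 0                       ≡⟨ cong₂ (λ x y → x + ∑< k h′ + y) (*-zeroʳ a) (*-zeroʳ b) ⟩
  ∑< k h′ + 0                                   ≡⟨ +-identityʳ _ ⟩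
  ∑< k h′                                       ≡⟨ ∑<-const k K inside ⟩
  k * K                                         ∎
  where
  open ≡-Reasoning
  h′ h″ : ℕ → ℕ
  h′ = h ∘ (a +_)
  h″ = h ∘ (a + k +_)

-- Streets and the parking process

Street : Set
Street = List (Maybe ℕ)

empties : ℕ → Street
empties k = replicate k nothing

just≢nothing : ∀ {x : ℕ} → just x ≢ nothing
just≢nothing ()

-- Spots past the end of a street read as empty, so lemmas about a hole also bound its position.
spot : Street → ℕ → Maybe ℕ
spot []       _       = nothing
spot (x ∷ xs) zero    = x
spot (x ∷ xs) (suc i) = spot xs i

length-empties : ∀ k → length (empties k) ≡ k
length-empties k = length-replicate k

spot-empties : ∀ n i → spot (empties n) i ≡ nothing
spot-empties zero    i       = refl
spot-empties (suc n) zero    = refl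
spot-empties (suc n) (suc i) = spot-empties n i

spot-occupied⇒< : ∀ st i {x} → spot st i ≡ just x → i < length st
spot-occupied⇒< (_ ∷ st) zero    _   = z<s
spot-occupied⇒< (_ ∷ st) (suc i) occ = s<s (spot-occupied⇒< st i occ)

isFull : Street → Bool
isFull = all is-just

full-spot : ∀ st i → T (isFull st) → i < length st → ∃ λ x → spot st i ≡ just x
full-spot (just x ∷ st) zero    _    _        = x , refl
full-spot (just x ∷ st) (suc i) full (s<s i<) = full-spot st i full i<

¬full-hole : ∀ st → ¬ T (isFull st) → ∃ λ e → e < length st × spot st e ≡ nothing
¬full-hole []             ¬full = ⊥-elim (¬full _)
¬full-hole (nothing ∷ st) _     = 0 , z<s , refl
¬full-hole (just x ∷ st)  ¬full with ¬full-hole st ¬full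
... | e , e< , hole = suc e , s<s e< , hole

data PlaceView (c p : ℕ) (st : Street) : Set where
  blocked : place c p st ≡ st →
            (∀ q → p ≤ q → q < length st → spot st q ≢ nothing) →
            PlaceView c p st
  parks   : ∀ q → p ≤ q → q < length st → spot st q ≡ nothing →
            (∀ r → p ≤ r → r < q → spot st r ≢ nothing) →
            spot (place c p st) q ≡ just c →
            (∀ i → i ≢ q → spot (place c p st) i ≡ spot st i) →
            PlaceView c p st

placeView : ∀ c p st → PlaceView c p st
placeView c p       []             = blocked refl λ _ _ ()
placeView c zero    (nothing ∷ xs) = parks 0 z≤n z<s refl (λ _ _ ()) refl others
  where
  others : ∀ i → i ≢ 0 → spot (just c ∷ xs) i ≡ spot (nothing ∷ xs) i
  others zero    i≢0 = ⊥-elim (i≢0 refl)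
  others (suc i) _   = refl
placeView c zero    (just d ∷ xs) with placeView c zero xs
... | blocked same full = blocked (cong (just d ∷_) same) full′
  where
  full′ : ∀ q → 0 ≤ q → q < suc (length xs) → spot (just d ∷ xs) q ≢ nothing
  full′ zero    _ _         ()
  full′ (suc q) _ (s<s q<) = full q z≤n q<
... | parks q _ q< free before lands others = parks (suc q) z≤n (s<s q<) free before′ lands others′
  where
  before′ : ∀ r → 0 ≤ r → r < suc q → spot (just d ∷ xs) r ≢ nothing
  before′ zero    _ _        ()
  before′ (suc r) _ (s<s r<) = before r z≤n r<
  others′ : ∀ i → i ≢ suc q → spot (just d ∷ place c zero xs) i ≡ spot (just d ∷ xs) i
  others′ zero    _   = refl
  others′ (suc i) i≢q = others i (i≢q ∘ cong suc)
placeView c (suc p) (x ∷ xs) with placeView c p xs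
... | blocked same full = blocked (cong (x ∷_) same) full′
  where
  full′ : ∀ q → suc p ≤ q → q < suc (length xs) → spot (x ∷ xs) q ≢ nothing
  full′ (suc q) (s≤s p≤q) (s<s q<) = full q p≤q q<
... | parks q p≤q q< free before lands others = parks (suc q) (s≤s p≤q) (s<s q<) free before′ lands others′
  where
  before′ : ∀ r → suc p ≤ r → r < suc q → spot (x ∷ xs) r ≢ nothing
  before′ (suc r) (s≤s p≤r) (s<s r<) = before r p≤r r<
  others′ : ∀ i → i ≢ suc q → spot (x ∷ place c p xs) i ≡ spot (x ∷ xs) i
  others′ zero    _   = refl
  others′ (suc i) i≢q = others i (i≢q ∘ cong suc)

length-place : ∀ c p st → length (place c p st) ≡ length st
length-place c p       []             = refl
length-place c zero    (nothing ∷ xs) = refl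
length-place c zero    (just d ∷ xs)  = cong suc (length-place c zero xs)
length-place c (suc p) (x ∷ xs)       = cong suc (length-place c p xs)

record Landing (c p : ℕ) (st : Street) (e : ℕ) : Set where
  field
    q        : ℕ
    p≤q      : p ≤ q
    q≤e      : q ≤ e
    was-free : spot st q ≡ nothing
    parked   : spot (place c p st) q ≡ just c
    others   : ∀ i → i ≢ q → spot (place c p st) i ≡ spot st i

place-lands-by : ∀ c p st e → p ≤ e → e < length st → spot st e ≡ nothing → Landing c p st e
place-lands-by c p st e p≤e e< free with placeView c p st
... | blocked _ full = ⊥-elim (full e p≤e e< free)
... | parks q p≤q _ hole before lands others with q ≤? e
...   | yes q≤e = record { q = q ; p≤q = p≤q ; q≤e = q≤e ; was-free = hole ; parked = lands ; others = others }
...   | no  q≰e = ⊥-elim (before e p≤e (≰⇒> q≰e) free)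

place-into-hole : ∀ c p st → spot st p ≡ nothing → p < length st →
                  spot (place c p st) p ≡ just c × (∀ i → i ≢ p → spot (place c p st) i ≡ spot st i)
place-into-hole c p st hole p< with place-lands-by c p st p ≤-refl p< hole
... | record { p≤q = p≤q ; q≤e = q≤p ; parked = parked ; others = others } with ≤-antisym q≤p p≤q
...   | refl = parked , others

place-keeps : ∀ c p st i {x} → spot st i ≡ just x → spot (place c p st) i ≡ just x
place-keeps c p st i occ with placeView c p st
... | blocked same _ = subst (λ st′ → spot st′ i ≡ _) (sym same) occ
... | parks q _ _ free _ _ others with i ≟ q
...   | yes refl = ⊥-elim (just≢nothing (trans (sym occ) free))
...   | no  i≢q  = trans (others i i≢q) occ

place-full : ∀ c p st → T (isFull st) → place c p st ≡ st
place-full c p       []            _    = refl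
place-full c zero    (just x ∷ st) full = cong (just x ∷_) (place-full c zero st full)
place-full c (suc p) (just x ∷ st) full = cong (just x ∷_) (place-full c p st full)

place-past-full : ∀ c p xs ys → T (isFull xs) → p ≤ length xs → place c p (xs ++ ys) ≡ xs ++ place c 0 ys
place-past-full c zero    []            ys _    _         = refl
place-past-full c zero    (just x ∷ xs) ys full _         = cong (just x ∷_) (place-past-full c zero xs ys full z≤n)
place-past-full c (suc p) (just x ∷ xs) ys full (s≤s p≤) = cong (just x ∷_) (place-past-full c p xs ys full p≤)

parkFrom : Street → ℕ → List ℕ → Street
parkFrom st c []       = st
parkFrom st c (p ∷ ps) = parkFrom (place c p st) (suc c) ps

length-parkFrom : ∀ st c ps → length (parkFrom st c ps) ≡ length st
length-parkFrom st c []       = refl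
length-parkFrom st c (p ∷ ps) = trans (length-parkFrom (place c p st) (suc c) ps) (length-place c p st)

parkFrom-keeps : ∀ st c ps i {x} → spot st i ≡ just x → spot (parkFrom st c ps) i ≡ just x
parkFrom-keeps st c []       i occ = occ
parkFrom-keeps st c (p ∷ ps) i occ = parkFrom-keeps (place c p st) (suc c) ps i (place-keeps c p st i occ)

parkFrom-settled : ∀ st c ps i {x d} → spot st i ≡ just x → spot (parkFrom st c ps) i ≡ just d → d ≡ x
parkFrom-settled st c ps i occ occ′ = just-injective (trans (sym occ′) (parkFrom-keeps st c ps i occ))

parkFrom-empty⇒empty : ∀ st c ps i → spot (parkFrom st c ps) i ≡ nothing → spot st i ≡ nothing
parkFrom-empty⇒empty st c ps i free with spot st i in eq
... | nothing = refl
... | just x  = ⊥-elim (just≢nothing (trans (sym (parkFrom-keeps st c ps i eq)) free))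

parkFrom-newcomer-≥ : ∀ st c ps i {d} → spot st i ≡ nothing → spot (parkFrom st c ps) i ≡ just d → c ≤ d
parkFrom-newcomer-≥ st c []       i free occ = ⊥-elim (just≢nothing (trans (sym occ) free))
parkFrom-newcomer-≥ st c (p ∷ ps) i free occ with placeView c p st
... | blocked same _ =
  <⇒≤ (parkFrom-newcomer-≥ (place c p st) (suc c) ps i (trans (cong (λ st′ → spot st′ i) same) free) occ)
... | parks q _ _ _ _ lands others with i ≟ q
...   | yes refl = ≤-reflexive (sym (parkFrom-settled (place c p st) (suc c) ps i lands occ))
...   | no  i≢q  = <⇒≤ (parkFrom-newcomer-≥ (place c p st) (suc c) ps i (trans (others i i≢q) free) occ)

parkFrom-newcomers-distinct : ∀ st c ps i j {d} → spot st i ≡ nothing → spot st j ≡ nothing →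
                              spot (parkFrom st c ps) i ≡ just d → spot (parkFrom st c ps) j ≡ just d → i ≡ j
parkFrom-newcomers-distinct st c [] i j free _ occ _ = ⊥-elim (just≢nothing (trans (sym occ) free))
parkFrom-newcomers-distinct st c (p ∷ ps) i j {d} freeᵢ freeⱼ occᵢ occⱼ with placeView c p st
... | blocked same _ =
  parkFrom-newcomers-distinct (place c p st) (suc c) ps i j
    (trans (cong (λ st′ → spot st′ i) same) freeᵢ) (trans (cong (λ st′ → spot st′ j) same) freeⱼ) occᵢ occⱼ
... | parks q _ _ _ _ lands others with i ≟ q | j ≟ q
...   | yes refl | yes refl = refl
...   | yes refl | no  j≢q  = ⊥-elim (1+n≰n (subst (suc c ≤_) (parkFrom-settled (place c p st) (suc c) ps i lands occᵢ)
                              (parkFrom-newcomer-≥ (place c p st) (suc c) ps j (trans (others j j≢q) freeⱼ) occⱼ)))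
...   | no  i≢q  | yes refl = ⊥-elim (1+n≰n (subst (suc c ≤_) (parkFrom-settled (place c p st) (suc c) ps j lands occⱼ)
                              (parkFrom-newcomer-≥ (place c p st) (suc c) ps i (trans (others i i≢q) freeᵢ) occᵢ)))
...   | no  i≢q  | no  j≢q  =
  parkFrom-newcomers-distinct (place c p st) (suc c) ps i j
    (trans (others i i≢q) freeᵢ) (trans (others j j≢q) freeⱼ) occᵢ occⱼ

parkAll≡parkFrom : ∀ n ps → length ps ≡ n → parkAll n ps ≡ parkFrom (empties n) 0 ps
parkAll≡parkFrom _ ps refl = foldl≡parkFrom ps _ 0 id (λ _ → refl)
  where
  foldl≡parkFrom : ∀ ps st c (f : ℕ → ℕ) → (∀ i → f i ≡ c + i) →
                   foldl (λ st cp → place (proj₁ cp) (proj₂ cp) st) st (zip (applyUpTo f (length ps)) ps)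
                     ≡ parkFrom st c ps
  foldl≡parkFrom []       st c f f≗c+ = refl
  foldl≡parkFrom (p ∷ ps) st c f f≗c+ rewrite f≗c+ 0 | +-identityʳ c =
    foldl≡parkFrom ps (place c p st) (suc c) (f ∘ suc) (λ i → trans (f≗c+ (suc i)) (+-suc c i))

-- Parking functions are the preference lists that fill the street

occupied : Maybe ℕ → ℕ
occupied nothing  = 0
occupied (just _) = 1

occupiedBelow : ℕ → Street → ℕ
occupiedBelow k st = ∑< k (occupied ∘ spot st)

occupiedBelow-hole : ∀ e st → spot st e ≡ nothing → occupiedBelow (suc e) st ≤ e
occupiedBelow-hole e st hole = begin
  occupiedBelow (suc e) st                       ≡⟨ ∑<-suc e (occupied ∘ spot st) ⟩
  occupiedBelow e st + occupied (spot st e)      ≡⟨ cong (λ m → occupiedBelow e st + occupied m) hole ⟩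
  occupiedBelow e st + 0                         ≡⟨ +-identityʳ _ ⟩
  occupiedBelow e st                             ≤⟨ ∑<-mono-≤ e (λ i _ → occupied≤1 (spot st i)) ⟩
  ∑< e (λ _ → 1)                                 ≡⟨ ∑<-const e 1 (λ _ _ → refl) ⟩
  e * 1                                          ≡⟨ *-identityʳ e ⟩
  e                                              ∎
  where
  open ≤-Reasoning
  occupied≤1 : ∀ m → occupied m ≤ 1
  occupied≤1 nothing  = z≤n
  occupied≤1 (just _) = s≤s z≤n

occupiedBelow-full : ∀ st k → T (isFull st) → k ≤ length st → occupiedBelow k st ≡ k
occupiedBelow-full st k full k≤ = trans (∑<-const k 1 one) (*-identityʳ k)
  where
  one : ∀ i → i < k → occupied (spot st i) ≡ 1
  one i i<k = cong occupied (proj₂ (full-spot st i full (<-≤-trans i<k k≤)))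

occupiedBelow-empties : ∀ n k → occupiedBelow k (empties n) ≡ 0
occupiedBelow-empties n k = trans (∑<-const k 0 (λ i _ → cong occupied (spot-empties n i))) (*-zeroʳ k)

occupiedBelow-fill : ∀ k st st′ q {x} → q < k → spot st q ≡ nothing → spot st′ q ≡ just x →
                     (∀ i → i ≢ q → spot st′ i ≡ spot st i) → occupiedBelow k st′ ≡ suc (occupiedBelow k st)
occupiedBelow-fill k st st′ q q<k hole filled others =
  ∑<-increment k q q<k (trans (cong occupied filled) (cong (suc ∘ occupied) (sym hole)))
                       (λ i i≢q → cong occupied (others i i≢q))

occupiedBelow-outside : ∀ k st st′ q → k ≤ q → (∀ i → i ≢ q → spot st′ i ≡ spot st i) →
                        occupiedBelow k st′ ≡ occupiedBelow k st
occupiedBelow-outside k st st′ q k≤q others =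
  ∑<-cong k (λ i i<k → cong occupied (others i (λ i≡q → <⇒≱ i<k (subst (k ≤_) (sym i≡q) k≤q))))

countLe-∷ : ∀ i p ps → countLe i (p ∷ ps) ≡ countLe i [ p ] + countLe i ps
countLe-∷ i p ps with p ≤ᵇ i
... | true  = refl
... | false = refl

countLe-≤ : ∀ {i p} → p ≤ i → countLe i [ p ] ≡ 1
countLe-≤ {i} {p} p≤i with p ≤ᵇ i | ≤⇒≤ᵇ p≤i
... | true | _ = refl

countLe-≰ : ∀ {i p} → ¬ p ≤ i → countLe i [ p ] ≡ 0
countLe-≰ {i} {p} p≰i with p ≤ᵇ i in eq
... | false = refl
... | true  = ⊥-elim (p≰i (≤ᵇ⇒≤ p i (subst T (sym eq) _)))

occupiedBelow-place-mono : ∀ k c p st → occupiedBelow k st ≤ occupiedBelow k (place c p st)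
occupiedBelow-place-mono k c p st with placeView c p st
... | blocked same _ = ≤-reflexive (cong (occupiedBelow k) (sym same))
... | parks q _ _ hole _ lands others with q <? k
...   | yes q<k = ≤-trans (n≤1+n _) (≤-reflexive (sym (occupiedBelow-fill k st (place c p st) q q<k hole lands others)))
...   | no  q≮k = ≤-reflexive (sym (occupiedBelow-outside k st (place c p st) q (≮⇒≥ q≮k) others))

occupiedBelow-place-≤ : ∀ i c p st → occupiedBelow (suc i) (place c p st) ≤ countLe i [ p ] + occupiedBelow (suc i) st
occupiedBelow-place-≤ i c p st with placeView c p st
... | blocked same _ = ≤-trans (≤-reflexive (cong (occupiedBelow (suc i)) same)) (m≤n+m _ (countLe i [ p ]))
... | parks q p≤q _ hole _ lands others with q ≤? i
...   | yes q≤i = ≤-reflexive (trans (occupiedBelow-fill (suc i) st (place c p st) q (s≤s q≤i) hole lands others)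
                                     (cong (_+ _) (sym (countLe-≤ (≤-trans p≤q q≤i)))))
...   | no  q≰i = ≤-trans (≤-reflexive (occupiedBelow-outside (suc i) st (place c p st) q (≰⇒> q≰i) others))
                        (m≤n+m _ (countLe i [ p ]))

occupiedBelow-place-≥ : ∀ e c p st → e < length st → spot (place c p st) e ≡ nothing →
                        countLe e [ p ] + occupiedBelow (suc e) st ≤ occupiedBelow (suc e) (place c p st)
occupiedBelow-place-≥ e c p st e< stillFree with p ≤? e
... | no  p≰e rewrite countLe-≰ p≰e = occupiedBelow-place-mono (suc e) c p st
... | yes p≤e rewrite countLe-≤ p≤e =
  ≤-reflexive (sym (occupiedBelow-fill (suc e) st (place c p st) q (s≤s q≤e) was-free parked others))
  where open Landing (place-lands-by c p st e p≤e e< (parkFrom-empty⇒empty st c [ p ] e stillFree))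

-- A car preferring a spot ≤ i parks at or after it, so among the spots ≤ i at most countLe i ps get filled, and
-- at least that many if spot i is still free at the end (every such car then parked before i).
occupiedBelow-parkFrom-≤ : ∀ i st c ps → occupiedBelow (suc i) (parkFrom st c ps) ≤ occupiedBelow (suc i) st + countLe i ps
occupiedBelow-parkFrom-≤ i st c []       = m≤m+n _ _
occupiedBelow-parkFrom-≤ i st c (p ∷ ps) = begin
  occupiedBelow (suc i) (parkFrom (place c p st) (suc c) ps)   ≤⟨ occupiedBelow-parkFrom-≤ i (place c p st) (suc c) ps ⟩
  occupiedBelow (suc i) (place c p st) + countLe i ps          ≤⟨ +-monoˡ-≤ _ (occupiedBelow-place-≤ i c p st) ⟩
  countLe i [ p ] + occupiedBelow (suc i) st + countLe i ps    ≡⟨ cong (_+ countLe i ps) (+-comm (countLe i [ p ]) _) ⟩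
  occupiedBelow (suc i) st + countLe i [ p ] + countLe i ps    ≡⟨ +-assoc (occupiedBelow (suc i) st) _ _ ⟩
  occupiedBelow (suc i) st + (countLe i [ p ] + countLe i ps)  ≡⟨ cong (_ +_) (countLe-∷ i p ps) ⟨
  occupiedBelow (suc i) st + countLe i (p ∷ ps)                ∎
  where open ≤-Reasoning

occupiedBelow-parkFrom-≥ : ∀ e st c ps → e < length st → spot (parkFrom st c ps) e ≡ nothing →
                           occupiedBelow (suc e) st + countLe e ps ≤ occupiedBelow (suc e) (parkFrom st c ps)
occupiedBelow-parkFrom-≥ e st c []       e< free = ≤-reflexive (+-identityʳ _)
occupiedBelow-parkFrom-≥ e st c (p ∷ ps) e< free = begin
  occupiedBelow (suc e) st + countLe e (p ∷ ps)                ≡⟨ cong (_ +_) (countLe-∷ e p ps) ⟩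
  occupiedBelow (suc e) st + (countLe e [ p ] + countLe e ps)  ≡⟨ +-assoc (occupiedBelow (suc e) st) _ _ ⟨
  occupiedBelow (suc e) st + countLe e [ p ] + countLe e ps    ≡⟨ cong (_+ countLe e ps) (+-comm _ (countLe e [ p ])) ⟩
  countLe e [ p ] + occupiedBelow (suc e) st + countLe e ps    ≤⟨ +-monoˡ-≤ _ (occupiedBelow-place-≥ e c p st e< stillFree) ⟩
  occupiedBelow (suc e) (place c p st) + countLe e ps          ≤⟨ occupiedBelow-parkFrom-≥ e (place c p st) (suc c) ps
                                                                    (subst (e <_) (sym (length-place c p st)) e<) free ⟩
  occupiedBelow (suc e) (parkFrom (place c p st) (suc c) ps)   ∎
  where
  open ≤-Reasoning
  stillFree : spot (place c p st) e ≡ nothing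
  stillFree = parkFrom-empty⇒empty (place c p st) (suc c) ps e free

T-all-upTo⁻ : ∀ P n → T (all P (upTo n)) → ∀ i → i < n → T (P i)
T-all-upTo⁻ P n allP i i<n = All.lookup (all⁺ P (upTo n) allP) (∈-upTo⁺ i<n)

T-all-upTo⁺ : ∀ P n → (∀ i → i < n → T (P i)) → T (all P (upTo n))
T-all-upTo⁺ P n allP = all⁻ P (All.tabulate (λ {i} i∈ → allP i (∈-upTo⁻ i∈)))

T⇔T⇒≡ : ∀ {a b} → (T a → T b) → (T b → T a) → a ≡ b
T⇔T⇒≡ {false} {false} _   _   = refl
T⇔T⇒≡ {false} {true}  _   b⇒a = ⊥-elim (b⇒a _)
T⇔T⇒≡ {true}  {false} a⇒b _   = ⊥-elim (a⇒b _)
T⇔T⇒≡ {true}  {true}  _   _   = refl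

¬T⇒≡false : ∀ {b} → ¬ T b → b ≡ false
¬T⇒≡false {false} _  = refl
¬T⇒≡false {true}  ¬t = ⊥-elim (¬t _)

module _ (n : ℕ) (ps : List ℕ) where

  private
    final : Street
    final = parkFrom (empties n) 0 ps

    length-final : length final ≡ n
    length-final = trans (length-parkFrom _ 0 ps) (length-empties n)

  hole⇒countLe≤ : ∀ e → e < n → spot final e ≡ nothing → countLe e ps ≤ e
  hole⇒countLe≤ e e<n hole = begin
    countLe e ps                                      ≡⟨ cong (_+ countLe e ps) (occupiedBelow-empties n (suc e)) ⟨
    occupiedBelow (suc e) (empties n) + countLe e ps  ≤⟨ occupiedBelow-parkFrom-≥ e (empties n) 0 ps
                                                           (subst (e <_) (sym (length-empties n)) e<n) hole ⟩
    occupiedBelow (suc e) final                       ≤⟨ occupiedBelow-hole e final hole ⟩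
    e                                                 ∎
    where open ≤-Reasoning

  countLe≥⇒full : (∀ i → i < n → suc i ≤ countLe i ps) → T (isFull final)
  countLe≥⇒full enough with T? (isFull final)
  ... | yes full = full
  ... | no  ¬full with ¬full-hole final ¬full
  ...   | e , e< , hole = ⊥-elim (<⇒≱ (s≤s (hole⇒countLe≤ e e<n hole)) (enough e e<n))
    where
    e<n : e < n
    e<n = subst (e <_) length-final e<

  full⇒countLe≥ : T (isFull final) → ∀ i → i < n → suc i ≤ countLe i ps
  full⇒countLe≥ full i i<n = begin
    suc i                                             ≡⟨ occupiedBelow-full final (suc i) full
                                                           (≤-trans i<n (≤-reflexive (sym length-final))) ⟨
    occupiedBelow (suc i) final                       ≤⟨ occupiedBelow-parkFrom-≤ i (empties n) 0 ps ⟩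
    occupiedBelow (suc i) (empties n) + countLe i ps  ≡⟨ cong (_+ countLe i ps) (occupiedBelow-empties n (suc i)) ⟩
    countLe i ps                                      ∎
    where open ≤-Reasoning

parkingFunction≡isFull : ∀ n ps → all (λ i → suc i ≤ᵇ countLe i ps) (upTo n) ≡ isFull (parkFrom (empties n) 0 ps)
parkingFunction≡isFull n ps = T⇔T⇒≡
  (λ pf → countLe≥⇒full n ps (λ i i<n → ≤ᵇ⇒≤ _ _ (T-all-upTo⁻ _ n pf i i<n)))
  (λ full → T-all-upTo⁺ _ n (λ i i<n → ≤⇒≤ᵇ (full⇒countLe≥ n ps full i i<n)))

block : ℕ → ℕ → Street
block a zero    = []
block a (suc k) = just a ∷ block (suc a) k

length-block : ∀ a k → length (block a k) ≡ k
length-block a zero    = refl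
length-block a (suc k) = cong suc (length-block (suc a) k)

isFull-block : ∀ a k → T (isFull (block a k))
isFull-block a zero    = _
isFull-block a (suc k) = isFull-block (suc a) k

isFull-++ : ∀ xs ys → T (isFull xs) → isFull (xs ++ ys) ≡ isFull ys
isFull-++ []            ys _    = refl
isFull-++ (just x ∷ xs) ys full = isFull-++ xs ys full

block-++-just : ∀ a k ys → block a k ++ just (a + k) ∷ ys ≡ block a (suc k) ++ ys
block-++-just a zero    ys = cong (λ x → just x ∷ ys) (+-identityʳ a)
block-++-just a (suc k) ys = cong (just a ∷_) (trans (cong (λ x → block (suc a) k ++ just x ∷ ys) (+-suc a k))
                                                     (block-++-just (suc a) k ys))

spot-block : ∀ a k i → i < k → spot (block a k) i ≡ just (a + i)
spot-block a (suc k) zero    _        = cong just (sym (+-identityʳ a))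
spot-block a (suc k) (suc i) (s<s i<) = trans (spot-block (suc a) k i i<) (cong just (sym (+-suc a i)))

spot-++ˡ : ∀ xs ys i → i < length xs → spot (xs ++ ys) i ≡ spot xs i
spot-++ˡ (x ∷ xs) ys zero    _        = refl
spot-++ˡ (x ∷ xs) ys (suc i) (s<s i<) = spot-++ˡ xs ys i i<

spot-skip-block : ∀ a k ys i → spot (block a k ++ ys) (k + i) ≡ spot ys i
spot-skip-block a zero    ys i = refl
spot-skip-block a (suc k) ys i = spot-skip-block (suc a) k ys i

spot-skip-empties : ∀ k ys i → spot (empties k ++ ys) (k + i) ≡ spot ys i
spot-skip-empties zero    ys i = refl
spot-skip-empties (suc k) ys i = spot-skip-empties k ys i

place-skip-block : ∀ c a k q ys → place c (k + q) (block a k ++ ys) ≡ block a k ++ place c q ys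
place-skip-block c a zero    q ys = refl
place-skip-block c a (suc k) q ys = cong (just a ∷_) (place-skip-block c (suc a) k q ys)

place-skip-empties : ∀ c k q ys → place c (k + q) (empties k ++ ys) ≡ empties k ++ place c q ys
place-skip-empties c zero    q ys = refl
place-skip-empties c (suc k) q ys = cong (nothing ∷_) (place-skip-empties c k q ys)

place-empties : ∀ c q e → place c q (empties (suc q + e)) ≡ empties q ++ just c ∷ empties e
place-empties c zero    e = refl
place-empties c (suc q) e = cong (nothing ∷_) (place-empties c q e)

emptySpots : Street → ℕ
emptySpots []             = 0
emptySpots (nothing ∷ xs) = suc (emptySpots xs)
emptySpots (just _ ∷ xs)  = emptySpots xs

emptySpots-place : ∀ c p st → emptySpots st ≤ suc (emptySpots (place c p st))
emptySpots-place c p       []             = z≤n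
emptySpots-place c zero    (nothing ∷ xs) = ≤-refl
emptySpots-place c zero    (just d ∷ xs)  = emptySpots-place c zero xs
emptySpots-place c (suc p) (nothing ∷ xs) = s≤s (emptySpots-place c p xs)
emptySpots-place c (suc p) (just d ∷ xs)  = emptySpots-place c p xs

emptySpots-parkFrom : ∀ st c ps → emptySpots st ≤ length ps + emptySpots (parkFrom st c ps)
emptySpots-parkFrom st c []       = ≤-refl
emptySpots-parkFrom st c (p ∷ ps) = ≤-trans (emptySpots-place c p st) (s≤s (emptySpots-parkFrom (place c p st) (suc c) ps))

emptySpots-full : ∀ st → T (isFull st) → emptySpots st ≡ 0
emptySpots-full []            _    = refl
emptySpots-full (just _ ∷ xs) full = emptySpots-full xs full

emptySpots-block-++ : ∀ a k ys → emptySpots (block a k ++ ys) ≡ emptySpots ys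
emptySpots-block-++ a zero    ys = refl
emptySpots-block-++ a (suc k) ys = emptySpots-block-++ (suc a) k ys

emptySpots-empties-++ : ∀ k ys → emptySpots (empties k ++ ys) ≡ k + emptySpots ys
emptySpots-empties-++ zero    ys = refl
emptySpots-empties-++ (suc k) ys = cong suc (emptySpots-empties-++ k ys)

-- Avoiding 213 and 321

∈-subseqs⁺ : ∀ {τ π : List ℕ} → τ ⊆ π → τ ∈ subseqs π
∈-subseqs⁺             []           = here refl
∈-subseqs⁺ {π = x ∷ π} (x ∷ʳ τ⊆π)   = ∈-++⁺ʳ (map (x ∷_) (subseqs π)) (∈-subseqs⁺ τ⊆π)
∈-subseqs⁺ {π = x ∷ π} (refl ∷ τ⊆π) = ∈-++⁺ˡ (∈-map⁺ (x ∷_) (∈-subseqs⁺ τ⊆π))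

∈-subseqs⁻ : ∀ {τ} (π : List ℕ) → τ ∈ subseqs π → τ ⊆ π
∈-subseqs⁻ []      (here refl) = []
∈-subseqs⁻ (x ∷ π) τ∈ with ∈-++⁻ (map (x ∷_) (subseqs π)) τ∈
... | inj₂ τ∈′ = x ∷ʳ ∈-subseqs⁻ π τ∈′
... | inj₁ τ∈′ with ∈-map⁻ (x ∷_) τ∈′
...   | _ , τ′∈ , refl = refl ∷ ∈-subseqs⁻ π τ′∈

contains⁺ : ∀ {τ π} σ → τ ⊆ π → T (orderIsoᵇ τ σ) → T (containsᵇ π σ)
contains⁺ σ τ⊆π iso = any⁺ (λ τ → orderIsoᵇ τ σ) (lose (∈-subseqs⁺ τ⊆π) iso)

contains⁻ : ∀ π σ → T (containsᵇ π σ) → ∃ λ τ → τ ⊆ π × T (orderIsoᵇ τ σ)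
contains⁻ π σ c with find (any⁻ (λ τ → orderIsoᵇ τ σ) (subseqs π) c)
... | τ , τ∈ , iso = τ , ∈-subseqs⁻ π τ∈ , iso

σ₂₁₃ σ₃₂₁ : List ℕ
σ₂₁₃ = 2 ∷ 1 ∷ 3 ∷ []
σ₃₂₁ = 3 ∷ 2 ∷ 1 ∷ []

<ᵇ-true : ∀ {a b} → a < b → (a <ᵇ b) ≡ true
<ᵇ-true {a} {b} a<b with a <ᵇ b | <⇒<ᵇ a<b
... | true | _ = refl

<ᵇ-false : ∀ {a b} → b ≤ a → (a <ᵇ b) ≡ false
<ᵇ-false {a} {b} b≤a with a <ᵇ b in eq
... | false = refl
... | true  = ⊥-elim (<⇒≱ (<ᵇ⇒< a b (subst T (sym eq) _)) b≤a)

iso-213⁺ : ∀ {x y z} → y < x → x < z → T (orderIsoᵇ (x ∷ y ∷ z ∷ []) σ₂₁₃)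
iso-213⁺ {x} {y} {z} y<x x<z
  rewrite <ᵇ-false {x} ≤-refl | <ᵇ-false {y} ≤-refl | <ᵇ-false {z} ≤-refl
        | <ᵇ-true y<x | <ᵇ-true x<z | <ᵇ-true (<-trans y<x x<z)
        | <ᵇ-false {x} (<⇒≤ y<x) | <ᵇ-false {z} (<⇒≤ x<z) | <ᵇ-false {z} (<⇒≤ (<-trans y<x x<z)) = _

iso-321⁺ : ∀ {x y z} → y < x → z < y → T (orderIsoᵇ (x ∷ y ∷ z ∷ []) σ₃₂₁)
iso-321⁺ {x} {y} {z} y<x z<y
  rewrite <ᵇ-false {x} ≤-refl | <ᵇ-false {y} ≤-refl | <ᵇ-false {z} ≤-refl
        | <ᵇ-true y<x | <ᵇ-true z<y | <ᵇ-true (<-trans z<y y<x)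
        | <ᵇ-false {x} (<⇒≤ y<x) | <ᵇ-false {y} (<⇒≤ z<y) | <ᵇ-false {x} (<⇒≤ (<-trans z<y y<x)) = _

iso-compare : ∀ τ σ → T (orderIsoᵇ τ σ) → ∀ {a b c d} → (a , b) ∈ zip τ σ → (c , d) ∈ zip τ σ →
              T ((a <ᵇ c) ==ᵇ (b <ᵇ d))
iso-compare τ σ iso ab∈ cd∈ =
  All.lookup (all⁺ _ (zip τ σ) (All.lookup (all⁺ _ (zip τ σ) (proj₂ (Equivalence.to T-∧ iso))) ab∈)) cd∈

==ᵇ-true : ∀ b → T (b ==ᵇ true) → T b
==ᵇ-true true _ = _

iso-213⁻ : ∀ τ → T (orderIsoᵇ τ σ₂₁₃) →
           ∃ λ x → ∃₂ λ y z → τ ≡ x ∷ y ∷ z ∷ [] × y < x × x < z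
iso-213⁻ τ@(x ∷ y ∷ z ∷ []) iso =
  x , y , z , refl , <ᵇ⇒< y x (==ᵇ-true _ (iso-compare τ σ₂₁₃ iso {y} {1} {x} {2} (there (here refl)) (here refl)))
                   , <ᵇ⇒< x z (==ᵇ-true _ (iso-compare τ σ₂₁₃ iso {x} {2} {z} {3} (here refl) (there (there (here refl)))))

iso-321⁻ : ∀ τ → T (orderIsoᵇ τ σ₃₂₁) →
           ∃ λ x → ∃₂ λ y z → τ ≡ x ∷ y ∷ z ∷ [] × y < x × z < y
iso-321⁻ τ@(x ∷ y ∷ z ∷ []) iso =
  x , y , z , refl , <ᵇ⇒< y x (==ᵇ-true _ (iso-compare τ σ₃₂₁ iso {y} {2} {x} {3} (there (here refl)) (here refl)))
                   , <ᵇ⇒< z y (==ᵇ-true _ (iso-compare τ σ₃₂₁ iso {z} {1} {y} {2}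
                                                         (there (there (here refl))) (there (here refl))))

avoided : List (List ℕ)
avoided = σ₂₁₃ ∷ σ₃₂₁ ∷ []

avoids-∷⁻ : ∀ π σ σs → T (avoidsAllᵇ π (σ ∷ σs)) → ¬ T (containsᵇ π σ) × T (avoidsAllᵇ π σs)
avoids-∷⁻ π σ σs avoids with Equivalence.to (T-∧ {not (containsᵇ π σ)} {avoidsAllᵇ π σs}) avoids
... | ¬c , rest = (λ c → subst T (Equivalence.to T-not-≡ ¬c) c) , rest

avoids-∷⁺ : ∀ π σ σs → ¬ T (containsᵇ π σ) → T (avoidsAllᵇ π σs) → T (avoidsAllᵇ π (σ ∷ σs))
avoids-∷⁺ π σ σs ¬c rest = Equivalence.from T-∧ (Equivalence.from T-not-≡ (¬T⇒≡false ¬c) , rest)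

contains-213⇒¬avoids : ∀ {π x y z} → x ∷ y ∷ z ∷ [] ⊆ π → y < x → x < z → ¬ T (avoidsAllᵇ π avoided)
contains-213⇒¬avoids {π} xyz⊆π y<x x<z avoids =
  proj₁ (avoids-∷⁻ π σ₂₁₃ (σ₃₂₁ ∷ []) avoids) (contains⁺ σ₂₁₃ xyz⊆π (iso-213⁺ y<x x<z))

contains-321⇒¬avoids : ∀ {π x y z} → x ∷ y ∷ z ∷ [] ⊆ π → y < x → z < y → ¬ T (avoidsAllᵇ π avoided)
contains-321⇒¬avoids {π} xyz⊆π y<x z<y avoids =
  proj₁ (avoids-∷⁻ π σ₃₂₁ [] (proj₂ (avoids-∷⁻ π σ₂₁₃ (σ₃₂₁ ∷ []) avoids)))
        (contains⁺ σ₃₂₁ xyz⊆π (iso-321⁺ y<x z<y))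

avoids-213-321 : ∀ π → (∀ {x y z} → x ∷ y ∷ z ∷ [] ⊆ π → y < x → y < z × z < x) → T (avoidsAllᵇ π avoided)
avoids-213-321 π between = avoids-∷⁺ π σ₂₁₃ (σ₃₂₁ ∷ []) no-213 (avoids-∷⁺ π σ₃₂₁ [] no-321 _)
  where
  no-213 : ¬ T (containsᵇ π σ₂₁₃)
  no-213 c with contains⁻ π σ₂₁₃ c
  ... | τ , τ⊆π , iso with iso-213⁻ τ iso
  ...   | x , y , z , refl , y<x , x<z = <-asym x<z (proj₂ (between τ⊆π y<x))
  no-321 : ¬ T (containsᵇ π σ₃₂₁)
  no-321 c with contains⁻ π σ₃₂₁ c
  ... | τ , τ⊆π , iso with iso-321⁻ τ iso
  ...   | x , y , z , refl , y<x , z<y = <-asym z<y (proj₁ (between τ⊆π y<x))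

⊆-++⁻ : ∀ {τ} (xs : List ℕ) {ys} → τ ⊆ xs ++ ys → ∃₂ λ τ₁ τ₂ → τ ≡ τ₁ ++ τ₂ × τ₁ ⊆ xs × τ₂ ⊆ ys
⊆-++⁻ []       τ⊆ = [] , _ , refl , [] , τ⊆
⊆-++⁻ (x ∷ xs) (x ∷ʳ τ⊆) with ⊆-++⁻ xs τ⊆
... | τ₁ , τ₂ , refl , τ₁⊆ , τ₂⊆ = τ₁ , τ₂ , refl , x ∷ʳ τ₁⊆ , τ₂⊆
⊆-++⁻ (x ∷ xs) (refl ∷ τ⊆) with ⊆-++⁻ xs τ⊆
... | τ₁ , τ₂ , refl , τ₁⊆ , τ₂⊆ = x ∷ τ₁ , τ₂ , refl , refl ∷ τ₁⊆ , τ₂⊆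

⊆-++⁻-single : ∀ {x} xs {ys} → x ∷ [] ⊆ xs ++ ys → x ∷ [] ⊆ xs ⊎ x ∷ [] ⊆ ys
⊆-++⁻-single xs x⊆ with ⊆-++⁻ xs x⊆
... | []        , _ , refl , _   , ⊆ys = inj₂ ⊆ys
... | _ ∷ []    , _ , refl , ⊆xs , _   = inj₁ ⊆xs
... | _ ∷ _ ∷ _ , _ , ()   , _   , _

⊆-++⁻-pair : ∀ {x y} xs {ys} → x ∷ y ∷ [] ⊆ xs ++ ys →
             x ∷ y ∷ [] ⊆ xs ⊎ (x ∷ [] ⊆ xs × y ∷ [] ⊆ ys) ⊎ x ∷ y ∷ [] ⊆ ys
⊆-++⁻-pair xs xy⊆ with ⊆-++⁻ xs xy⊆
... | []             , _ , refl , _  , ⊆ys = inj₂ (inj₂ ⊆ys)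
... | _ ∷ []         , _ , refl , ⊆xs , ⊆ys = inj₂ (inj₁ (⊆xs , ⊆ys))
... | _ ∷ _ ∷ []     , _ , refl , ⊆xs , _  = inj₁ ⊆xs
... | _ ∷ _ ∷ _ ∷ _  , _ , ()   , _  , _

block-⊆-bounds : ∀ a k {x τ} → x ∷ τ ⊆ catMaybes (block a k) → a ≤ x × x < a + k
block-⊆-bounds a (suc k) (refl ∷ _) = ≤-refl , subst (a <_) (sym (+-suc a k)) (s≤s (m≤m+n a k))
block-⊆-bounds a (suc k) {x} (_ ∷ʳ x⊆) with block-⊆-bounds (suc a) k x⊆
... | a<x , x< = <⇒≤ a<x , subst (x <_) (sym (+-suc a k)) x<

block-⊆-increasing : ∀ a k {x y τ} → x ∷ y ∷ τ ⊆ catMaybes (block a k) → x < y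
block-⊆-increasing a (suc k) (refl ∷ y⊆) = proj₁ (block-⊆-bounds (suc a) k y⊆)
block-⊆-increasing a (suc k) (_ ∷ʳ xy⊆)  = block-⊆-increasing (suc a) k xy⊆

catMaybes-∷-⊆ : ∀ m (L : Street) {τ} → τ ⊆ catMaybes L → τ ⊆ catMaybes (m ∷ L)
catMaybes-∷-⊆ nothing  L τ⊆ = τ⊆
catMaybes-∷-⊆ (just x) L τ⊆ = x ∷ʳ τ⊆

spot-⊆ : ∀ L k {z} → spot L k ≡ just z → z ∷ [] ⊆ catMaybes L
spot-⊆ (just z ∷ L) zero    refl = refl ∷ []⊆-universal (catMaybes L)
spot-⊆ (m ∷ L)      (suc k) occ  = catMaybes-∷-⊆ m L (spot-⊆ L k occ)

spots-⊆₂ : ∀ L j k {y z} → j < k → spot L j ≡ just y → spot L k ≡ just z → y ∷ z ∷ [] ⊆ catMaybes L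
spots-⊆₂ (just y ∷ L) zero    (suc k) _         refl occ  = refl ∷ spot-⊆ L k occ
spots-⊆₂ (m ∷ L)      (suc j) (suc k) (s<s j<k) occ₁ occ₂ = catMaybes-∷-⊆ m L (spots-⊆₂ L j k j<k occ₁ occ₂)

spots-⊆₃ : ∀ L i j k {x y z} → i < j → j < k → spot L i ≡ just x → spot L j ≡ just y → spot L k ≡ just z →
           x ∷ y ∷ z ∷ [] ⊆ catMaybes L
spots-⊆₃ (just x ∷ L) zero    (suc j) (suc k) _         (s<s j<k) refl occ₂ occ₃ = refl ∷ spots-⊆₂ L j k j<k occ₂ occ₃
spots-⊆₃ (m ∷ L)      (suc i) (suc j) (suc k) (s<s i<j) (s<s j<k) occ₁ occ₂ occ₃ =
  catMaybes-∷-⊆ m L (spots-⊆₃ L i j k i<j j<k occ₁ occ₂ occ₃)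

-- Accepted and rejected streets

accepts : List (List ℕ) → Street → Bool
accepts σs st = isFull st ∧ avoidsAllᵇ (catMaybes st) σs

accepts⁻ : ∀ σs st → T (accepts σs st) → T (isFull st) × T (avoidsAllᵇ (catMaybes st) σs)
accepts⁻ σs st = Equivalence.to (T-∧ {isFull st})

parkFrom-fills : ∀ st c ps e → spot st e ≡ nothing → e < length st → T (isFull (parkFrom st c ps)) →
                 ∃ λ d → spot (parkFrom st c ps) e ≡ just d × c ≤ d
parkFrom-fills st c ps e hole e< full
  with full-spot (parkFrom st c ps) e full (subst (e <_) (sym (length-parkFrom st c ps)) e<)
... | d , occ = d , occ , parkFrom-newcomer-≥ st c ps e hole occ

module _ (st : Street) (c : ℕ) (ps : List ℕ) where

  private
    final : Street
    final = parkFrom st c ps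

  rejects-213 : ∀ {a b} i j e → spot st i ≡ just b → spot st j ≡ just a → spot st e ≡ nothing →
                i < j → j < e → e < length st → a < b → b < c → ¬ T (accepts avoided final)
  rejects-213 i j e occᵢ occⱼ hole i<j j<e e< a<b b<c acc with accepts⁻ avoided final acc
  ... | full , avoids with parkFrom-fills st c ps e hole e< full
  ...   | d , occₑ , c≤d =
    contains-213⇒¬avoids (spots-⊆₃ final i j e i<j j<e (parkFrom-keeps st c ps i occᵢ) (parkFrom-keeps st c ps j occⱼ) occₑ)
                         a<b (<-≤-trans b<c c≤d) avoids

  rejects-321 : ∀ {a b} e i j → spot st e ≡ nothing → spot st i ≡ just b → spot st j ≡ just a →
                e < i → i < j → j < length st → a < b → b < c → ¬ T (accepts avoided final)
  rejects-321 e i j hole occᵢ occⱼ e<i i<j j< a<b b<c acc with accepts⁻ avoided final acc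
  ... | full , avoids with parkFrom-fills st c ps e hole (<-trans e<i (<-trans i<j j<)) full
  ...   | d , occₑ , c≤d =
    contains-321⇒¬avoids (spots-⊆₃ final e i j e<i i<j occₑ (parkFrom-keeps st c ps i occᵢ) (parkFrom-keeps st c ps j occⱼ))
                         (<-≤-trans b<c c≤d) a<b avoids

  rejects-two-holes : ∀ {a b} e₁ i e₂ j → spot st e₁ ≡ nothing → spot st i ≡ just b → spot st e₂ ≡ nothing →
                      spot st j ≡ just a → e₁ < i → i < e₂ → e₂ < j → j < length st → a < c → b < c →
                      ¬ T (accepts avoided final)
  rejects-two-holes e₁ i e₂ j hole₁ occᵢ hole₂ occⱼ e₁<i i<e₂ e₂<j j< a<c b<c acc with accepts⁻ avoided final acc
  ... | full , avoids
      with parkFrom-fills st c ps e₁ hole₁ (<-trans e₁<i (<-trans i<e₂ (<-trans e₂<j j<))) full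
         | parkFrom-fills st c ps e₂ hole₂ (<-trans e₂<j j<) full
  ...   | d₁ , occ₁ , c≤d₁ | d₂ , occ₂ , c≤d₂ with <-cmp d₁ d₂
  -- d₁ b d₂ is a 213 or d₁ d₂ a is a 321, and the two holes cannot receive the same car.
  ...     | tri< d₁<d₂ _ _ =
    contains-213⇒¬avoids (spots-⊆₃ final e₁ i e₂ e₁<i i<e₂ occ₁ (parkFrom-keeps st c ps i occᵢ) occ₂)
                         (<-≤-trans b<c c≤d₁) d₁<d₂ avoids
  ...     | tri≈ _ refl _ =
    <-irrefl (parkFrom-newcomers-distinct st c ps e₁ e₂ hole₁ hole₂ occ₁ occ₂) (<-trans e₁<i i<e₂)
  ...     | tri> _ _ d₂<d₁ =
    contains-321⇒¬avoids (spots-⊆₃ final e₁ e₂ j (<-trans e₁<i i<e₂) e₂<j occ₁ occ₂ (parkFrom-keeps st c ps j occⱼ))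
                         d₂<d₁ (<-≤-trans a<c c≤d₂) avoids

rejects-too-few-cars : ∀ σs st c ps → length ps < emptySpots st → ¬ T (accepts σs (parkFrom st c ps))
rejects-too-few-cars σs st c ps few acc = <⇒≱ few (begin
  emptySpots st                              ≤⟨ emptySpots-parkFrom st c ps ⟩
  length ps + emptySpots (parkFrom st c ps)  ≡⟨ cong (length ps +_) (emptySpots-full final (proj₁ (accepts⁻ σs final acc))) ⟩
  length ps + 0                              ≡⟨ +-identityʳ _ ⟩
  length ps                                  ∎)
  where
  open ≤-Reasoning
  final : Street
  final = parkFrom st c ps

-- In 0 … s−1, s+m … s+m+t−1, s … s+m−1 every descent goes from the middle run into the last one, and
-- everything after its smaller entry lies strictly between the two: no 213 and no 321.
module _ (s t m : ℕ) where

  goodStreet : Street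
  goodStreet = block 0 s ++ block (s + m) t ++ block s m

  private
    A B C : List ℕ
    A = catMaybes (block 0 s)
    B = catMaybes (block (s + m) t)
    C = catMaybes (block s m)

    descent : ∀ {x y} → x ∷ y ∷ [] ⊆ A ++ B ++ C → y < x → s + m ≤ x × s ≤ y × y < s + m
    descent {x} {y} xy⊆ y<x with ⊆-++⁻-pair A xy⊆
    ... | inj₁ xy⊆A = ⊥-elim (<-asym y<x (block-⊆-increasing 0 s xy⊆A))
    ... | inj₂ (inj₁ (x⊆A , y⊆BC)) = ⊥-elim (<-asym y<x (<-≤-trans (proj₂ (block-⊆-bounds 0 s x⊆A)) s≤y))
      where
      s≤y : s ≤ y
      s≤y with ⊆-++⁻-single B y⊆BC
      ... | inj₁ y⊆B = ≤-trans (m≤m+n s m) (proj₁ (block-⊆-bounds (s + m) t y⊆B))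
      ... | inj₂ y⊆C = proj₁ (block-⊆-bounds s m y⊆C)
    ... | inj₂ (inj₂ xy⊆BC) with ⊆-++⁻-pair B xy⊆BC
    ...   | inj₁ xy⊆B = ⊥-elim (<-asym y<x (block-⊆-increasing (s + m) t xy⊆B))
    ...   | inj₂ (inj₁ (x⊆B , y⊆C)) = proj₁ (block-⊆-bounds (s + m) t x⊆B) , block-⊆-bounds s m y⊆C
    ...   | inj₂ (inj₂ xy⊆C) = ⊥-elim (<-asym y<x (block-⊆-increasing s m xy⊆C))

    after-descent : ∀ {y z} → y ∷ z ∷ [] ⊆ A ++ B ++ C → s ≤ y → y < s + m → y < z × z < s + m
    after-descent yz⊆ s≤y y< with ⊆-++⁻-pair A yz⊆
    ... | inj₁ yz⊆A = ⊥-elim (<⇒≱ (proj₂ (block-⊆-bounds 0 s yz⊆A)) s≤y)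
    ... | inj₂ (inj₁ (y⊆A , _)) = ⊥-elim (<⇒≱ (proj₂ (block-⊆-bounds 0 s y⊆A)) s≤y)
    ... | inj₂ (inj₂ yz⊆BC) with ⊆-++⁻-pair B yz⊆BC
    ...   | inj₁ yz⊆B = ⊥-elim (<⇒≱ y< (proj₁ (block-⊆-bounds (s + m) t yz⊆B)))
    ...   | inj₂ (inj₁ (y⊆B , _)) = ⊥-elim (<⇒≱ y< (proj₁ (block-⊆-bounds (s + m) t y⊆B)))
    ...   | inj₂ (inj₂ yz⊆C) = block-⊆-increasing s m yz⊆C , proj₂ (block-⊆-bounds s m (∷ˡ⁻ yz⊆C))

  goodStreet-accepted : T (accepts avoided goodStreet)
  goodStreet-accepted = Equivalence.from T-∧ (full , subst (λ π → T (avoidsAllᵇ π avoided)) (sym perm) avoids)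
    where
    full : T (isFull goodStreet)
    full rewrite isFull-++ (block 0 s) (block (s + m) t ++ block s m) (isFull-block 0 s)
               | isFull-++ (block (s + m) t) (block s m) (isFull-block (s + m) t) = isFull-block s m
    perm : catMaybes goodStreet ≡ A ++ B ++ C
    perm = trans (catMaybes-++ (block 0 s) _) (cong (A ++_) (catMaybes-++ (block (s + m) t) _))
    avoids : T (avoidsAllᵇ (A ++ B ++ C) avoided)
    avoids = avoids-213-321 (A ++ B ++ C) λ {x} {y} {z} xyz⊆ y<x →
      let s+m≤x , s≤y , y< = descent (⊆-trans (refl ∷ refl ∷ z ∷ʳ []) xyz⊆) y<x
          y<z , z< = after-descent (∷ˡ⁻ xyz⊆) s≤y y<
      in y<z , <-≤-trans z< s+m≤x

-- Counting completions

length-filterᵇ-concat : ∀ {A : Set} (P : A → Bool) xss →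
                        length (filterᵇ P (concat xss)) ≡ sum (map (length ∘ filterᵇ P) xss)
length-filterᵇ-concat P []         = refl
length-filterᵇ-concat P (xs ∷ xss) = begin
  length (filterᵇ P (xs ++ concat xss))                       ≡⟨ cong length (filter-++ (T? ∘ P) xs (concat xss)) ⟩
  length (filterᵇ P xs ++ filterᵇ P (concat xss))             ≡⟨ length-++ (filterᵇ P xs) ⟩
  length (filterᵇ P xs) + length (filterᵇ P (concat xss))     ≡⟨ cong (_ +_) (length-filterᵇ-concat P xss) ⟩
  length (filterᵇ P xs) + sum (map (length ∘ filterᵇ P) xss)  ∎
  where open ≡-Reasoning

length-filterᵇ-map : ∀ {A B : Set} (P : B → Bool) (g : A → B) xs →
                     length (filterᵇ P (map g xs)) ≡ length (filterᵇ (P ∘ g) xs)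
length-filterᵇ-map P g []       = refl
length-filterᵇ-map P g (x ∷ xs) with P (g x)
... | true  = cong suc (length-filterᵇ-map P g xs)
... | false = length-filterᵇ-map P g xs

sum-map-allFin : ∀ n (h : ℕ → ℕ) → sum (map (h ∘ toℕ) (allFin n)) ≡ ∑< n h
sum-map-allFin n h = trans (cong sum (map-tabulate {n = n} id (h ∘ toℕ))) (sum-tabulate n h)
  where
  sum-tabulate : ∀ n (h : ℕ → ℕ) → sum (tabulate {n = n} (h ∘ toℕ)) ≡ ∑< n h
  sum-tabulate zero    h = refl
  sum-tabulate (suc n) h = cong (h 0 +_) (sum-tabulate n (h ∘ suc))

module Completions (σs : List (List ℕ)) (n : ℕ) where

  prefsOf : ∀ {k} → Vec (Fin n) k → List ℕ
  prefsOf v = map toℕ (toList v)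

  length-prefsOf : ∀ {k} (v : Vec (Fin n) k) → length (prefsOf v) ≡ k
  length-prefsOf v = trans (length-map toℕ (toList v)) (length-toList v)

  completions : Street → ℕ → ℕ → ℕ
  completions st c k = length (filterᵇ (λ v → accepts σs (parkFrom st c (prefsOf v))) (allVecs k n))

  completions-done : ∀ st c → T (accepts σs st) → completions st c 0 ≡ 1
  completions-done st c acc rewrite Equivalence.to T-≡ acc = refl

  completions-rejected : ∀ st c k → (∀ ps → length ps ≡ k → ¬ T (accepts σs (parkFrom st c ps))) →
                         completions st c k ≡ 0
  completions-rejected st c k rejected =
    cong length (filter-none _ (All.universal (λ v → rejected (prefsOf v) (length-prefsOf v)) (allVecs k n)))

  completions-suc : ∀ st c k → completions st c (suc k) ≡ ∑< n (λ p → completions (place c p st) (suc c) k)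
  completions-suc st c k = begin
    length (filterᵇ P (concat (map extend (allFin n))))
      ≡⟨ length-filterᵇ-concat P (map extend (allFin n)) ⟩
    sum (map (length ∘ filterᵇ P) (map extend (allFin n)))
      ≡⟨ cong sum (map-∘ (allFin n)) ⟨
    sum (map (λ i → length (filterᵇ P (extend i))) (allFin n))
      ≡⟨ cong sum (map-cong (λ i → length-filterᵇ-map P (i ∷ᵛ_) (allVecs k n)) (allFin n)) ⟩
    sum (map ((λ p → completions (place c p st) (suc c) k) ∘ toℕ) (allFin n))
      ≡⟨ sum-map-allFin n (λ p → completions (place c p st) (suc c) k) ⟩
    ∑< n (λ p → completions (place c p st) (suc c) k)
      ∎
    where
    open ≡-Reasoning
    P : Vec (Fin n) (suc k) → Bool
    P v = accepts σs (parkFrom st c (prefsOf v))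
    extend : Fin n → List (Vec (Fin n) (suc k))
    extend i = map (i ∷ᵛ_) (allVecs k n)

pk≡completions : ∀ n σs → pk n σs ≡ Completions.completions σs n (empties n) 0 n
pk≡completions n σs =
  cong length (filter-≐ (T? ∘ _) (T? ∘ _) ((λ {f} → subst T (same f)) , (λ {f} → subst T (sym (same f)))) (allVecs n n))
  where
  open Completions σs n using (prefsOf; length-prefsOf)
  same : ∀ f → isParkingFunction f ∧ avoidsAllᵇ (parkingPerm f) σs ≡ accepts σs (parkFrom (empties n) 0 (prefs f))
  same f = cong₂ (λ full perm → full ∧ avoidsAllᵇ (catMaybes perm) σs)
                 (parkingFunction≡isFull n (prefs f)) (parkAll≡parkFrom n (prefs f) (length-prefsOf f))

-- The streets reached from the empty one

tailStreet : ℕ → ℕ → ℕ → ℕ → Street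
tailStreet s t g m = block 0 s ++ block (s + m) t ++ empties g ++ block s m

spot-tailStreet-gap : ∀ s t g m i → i < g → spot (tailStreet s t g m) (s + t + i) ≡ nothing
spot-tailStreet-gap s t g m i i<g
  rewrite +-assoc s t i | spot-skip-block 0 s (block (s + m) t ++ empties g ++ block s m) (t + i)
        | spot-skip-block (s + m) t (empties g ++ block s m) i =
  trans (spot-++ˡ (empties g) (block s m) i (subst (i <_) (sym (length-empties g)) i<g)) (spot-empties g i)

spot-tailStreet-last : ∀ s t g m r → r < m → spot (tailStreet s t g m) (s + t + g + r) ≡ just (s + r)
spot-tailStreet-last s t g m r r<m
  rewrite +-assoc (s + t) g r | +-assoc s t (g + r)
        | spot-skip-block 0 s (block (s + m) t ++ empties g ++ block s m) (t + (g + r))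
        | spot-skip-block (s + m) t (empties g ++ block s m) (g + r) | spot-skip-empties g (block s m) r =
  spot-block s m r r<m

place-tailStreet-front : ∀ s t g m p → p ≤ s + t →
                         place (s + m + t) p (tailStreet s t (suc g) m) ≡ tailStreet s (suc t) g m
place-tailStreet-front s t g m p p≤ = begin
  place c p (block 0 s ++ block (s + m) t ++ nothing ∷ rest)
    ≡⟨ cong (place c p) (++-assoc (block 0 s) _ _) ⟨
  place c p ((block 0 s ++ block (s + m) t) ++ nothing ∷ rest)
    ≡⟨ place-past-full c p (block 0 s ++ block (s + m) t) _ full p≤′ ⟩
  (block 0 s ++ block (s + m) t) ++ just c ∷ rest
    ≡⟨ ++-assoc (block 0 s) _ _ ⟩
  block 0 s ++ block (s + m) t ++ just c ∷ rest
    ≡⟨ cong (block 0 s ++_) (block-++-just (s + m) t rest) ⟩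
  block 0 s ++ block (s + m) (suc t) ++ rest
    ∎
  where
  open ≡-Reasoning
  c : ℕ
  c = s + m + t
  rest : Street
  rest = empties g ++ block s m
  full : T (isFull (block 0 s ++ block (s + m) t))
  full rewrite isFull-++ (block 0 s) (block (s + m) t) (isFull-block 0 s) = isFull-block (s + m) t
  p≤′ : p ≤ length (block 0 s ++ block (s + m) t)
  p≤′ rewrite length-++ (block 0 s) {block (s + m) t} | length-block 0 s | length-block (s + m) t = p≤

place-tailStreet-past-gap : ∀ c s t g m r → place c (s + t + g + r) (tailStreet s t g m) ≡ tailStreet s t g m
place-tailStreet-past-gap c s t g m r = begin
  place c (s + t + g + r) (tailStreet s t g m)
    ≡⟨ cong (λ p → place c p (tailStreet s t g m)) (trans (+-assoc (s + t) g r) (+-assoc s t (g + r))) ⟩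
  place c (s + (t + (g + r))) (tailStreet s t g m)
    ≡⟨ place-skip-block c 0 s _ _ ⟩
  block 0 s ++ place c (t + (g + r)) (block (s + m) t ++ empties g ++ block s m)
    ≡⟨ cong (block 0 s ++_) (place-skip-block c (s + m) t _ _) ⟩
  block 0 s ++ block (s + m) t ++ place c (g + r) (empties g ++ block s m)
    ≡⟨ cong (λ st → block 0 s ++ block (s + m) t ++ st) (place-skip-empties c g r _) ⟩
  block 0 s ++ block (s + m) t ++ empties g ++ place c r (block s m)
    ≡⟨ cong (λ st → block 0 s ++ block (s + m) t ++ empties g ++ st) (place-full c r (block s m) (isFull-block s m)) ⟩
  tailStreet s t g m
    ∎
  where open ≡-Reasoning

gapStreet : ℕ → ℕ → ℕ → ℕ → Street
gapStreet s g j e = block 0 s ++ empties g ++ block s j ++ empties e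

length-gapStreet : ∀ s g j e → length (gapStreet s g j e) ≡ s + g + j + e
length-gapStreet s g j e = begin
  length (block 0 s ++ empties g ++ block s j ++ empties e)
    ≡⟨ length-++ (block 0 s) ⟩
  length (block 0 s) + length (empties g ++ block s j ++ empties e)
    ≡⟨ cong₂ _+_ (length-block 0 s) (trans (length-++ (empties g)) (cong₂ _+_ (length-empties g)
         (trans (length-++ (block s j)) (cong₂ _+_ (length-block s j) (length-empties e))))) ⟩
  s + (g + (j + e))
    ≡⟨ solve (s ∷ g ∷ j ∷ e ∷ []) ⟩
  s + g + j + e
    ∎
  where open ≡-Reasoning

spot-gapStreet-gap : ∀ s g j e i → i < g → spot (gapStreet s g j e) (s + i) ≡ nothing
spot-gapStreet-gap s g j e i i<g rewrite spot-skip-block 0 s (empties g ++ block s j ++ empties e) i =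
  trans (spot-++ˡ (empties g) _ i (subst (i <_) (sym (length-empties g)) i<g)) (spot-empties g i)

spot-gapStreet-block : ∀ s g j e r → r < j → spot (gapStreet s g j e) (s + g + r) ≡ just (s + r)
spot-gapStreet-block s g j e r r<j
  rewrite +-assoc s g r | spot-skip-block 0 s (empties g ++ block s j ++ empties e) (g + r)
        | spot-skip-empties g (block s j ++ empties e) r =
  trans (spot-++ˡ (block s j) (empties e) r (subst (r <_) (sym (length-block s j)) r<j)) (spot-block s j r r<j)

spot-gapStreet-tail : ∀ s g j e i → spot (gapStreet s g j e) (s + g + j + i) ≡ nothing
spot-gapStreet-tail s g j e i
  rewrite +-assoc (s + g) j i | +-assoc s g (j + i)
        | spot-skip-block 0 s (empties g ++ block s j ++ empties e) (g + (j + i))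
        | spot-skip-empties g (block s j ++ empties e) (j + i) | spot-skip-block s j (empties e) i =
  spot-empties e i

place-gapStreet-block : ∀ s g j e i → i ≤ j →
                        place (s + j) (s + g + i) (gapStreet s g j (suc e)) ≡ gapStreet s g (suc j) e
place-gapStreet-block s g j e i i≤j = begin
  place c (s + g + i) (gapStreet s g j (suc e))
    ≡⟨ cong (λ p → place c p (gapStreet s g j (suc e))) (+-assoc s g i) ⟩
  place c (s + (g + i)) (gapStreet s g j (suc e))
    ≡⟨ place-skip-block c 0 s (g + i) _ ⟩
  block 0 s ++ place c (g + i) (empties g ++ block s j ++ empties (suc e))
    ≡⟨ cong (block 0 s ++_) (place-skip-empties c g i _) ⟩
  block 0 s ++ empties g ++ place c i (block s j ++ empties (suc e))
    ≡⟨ cong (λ st → block 0 s ++ empties g ++ st)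
            (place-past-full c i (block s j) _ (isFull-block s j) (subst (i ≤_) (sym (length-block s j)) i≤j)) ⟩
  block 0 s ++ empties g ++ block s j ++ just c ∷ empties e
    ≡⟨ cong (λ st → block 0 s ++ empties g ++ st) (block-++-just s j (empties e)) ⟩
  gapStreet s g (suc j) e
    ∎
  where
  open ≡-Reasoning
  c : ℕ
  c = s + j

prefixStreet : ℕ → ℕ → Street
prefixStreet c r = block 0 c ++ empties r

place-prefixStreet-front : ∀ c r p → p ≤ c → place c p (prefixStreet c (suc r)) ≡ prefixStreet (suc c) r
place-prefixStreet-front c r p p≤c =
  trans (place-past-full c p (block 0 c) _ (isFull-block 0 c) (subst (p ≤_) (sym (length-block 0 c)) p≤c))
        (block-++-just 0 c (empties r))

place-prefixStreet-gap : ∀ c q e → place c (suc c + q) (prefixStreet c (suc (suc q + e))) ≡ gapStreet c (suc q) 1 e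
place-prefixStreet-gap c q e = begin
  place c (suc c + q) (prefixStreet c (suc (suc q + e)))
    ≡⟨ cong (λ p → place c p (prefixStreet c (suc (suc q + e)))) (+-suc c q) ⟨
  place c (c + suc q) (block 0 c ++ empties (suc (suc q + e)))
    ≡⟨ place-skip-block c 0 c (suc q) _ ⟩
  block 0 c ++ nothing ∷ place c q (empties (suc q + e))
    ≡⟨ cong (λ st → block 0 c ++ nothing ∷ st) (place-empties c q e) ⟩
  gapStreet c (suc q) 1 e
    ∎
  where open ≡-Reasoning

-- surplus 0 n is the paper's n! · Σ_{k<n} k / C(n,k).
surplus : ℕ → ℕ → ℕ
surplus c r = ∑< r (λ i → i * ((c + i) ! * (r ∸ i) !))

surplus-suc : ∀ c r → surplus c (suc r) ≡ ∑< r (λ i → (c + suc i) ! * (r ∸ i) !) + surplus (suc c) r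
surplus-suc c r =
  trans (∑<-distrib-+ r _ _)
        (cong (∑< r (λ i → (c + suc i) ! * (r ∸ i) !) +_)
              (∑<-cong r (λ i _ → cong (λ x → i * (x ! * (r ∸ i) !)) (+-suc c i))))

[1+a]*k*a!≡k*[1+a]! : ∀ a k → suc a * k * a ! ≡ k * suc a !
[1+a]*k*a!≡k*[1+a]! a k = trans (cong (_* a !) (*-comm (suc a) k)) (*-assoc k (suc a) (a !))

module Counting (n : ℕ) where
  open Completions avoided n

  tailStreet-gap-rejected : ∀ s t g m k i → i < g → 0 < m →
    completions (place (s + m + t) (s + t + suc i) (tailStreet s t (suc g) m)) (suc (s + m + t)) k ≡ 0
  tailStreet-gap-rejected s t g m k i i<g 0<m = completions-rejected st′ (suc c) k λ ps _ →
    rejects-321 st′ (suc c) ps pₕ p pₛ hole′ (proj₁ filled) occ′ pₕ<p p<pₛ (spot-occupied⇒< st′ pₛ occ′)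
                s<c (n<1+n c)
    where
    c p pₕ pₛ : ℕ
    c = s + m + t
    p = s + t + suc i
    pₕ = s + t + 0
    pₛ = s + t + suc g + 0
    st st′ : Street
    st = tailStreet s t (suc g) m
    st′ = place c p st
    pₕ<p : pₕ < p
    pₕ<p = +-monoʳ-< (s + t) z<s
    p<pₛ : p < pₛ
    p<pₛ = subst (p <_) (sym (+-identityʳ _)) (+-monoʳ-< (s + t) (s<s i<g))
    occ : spot st pₛ ≡ just (s + 0)
    occ = spot-tailStreet-last s t (suc g) m 0 0<m
    filled : spot st′ p ≡ just c × (∀ i → i ≢ p → spot st′ i ≡ spot st i)
    filled = place-into-hole c p st (spot-tailStreet-gap s t (suc g) m (suc i) (s<s i<g))
                             (<-trans p<pₛ (spot-occupied⇒< st pₛ occ))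
    hole′ : spot st′ pₕ ≡ nothing
    hole′ = trans (proj₂ filled pₕ (<⇒≢ pₕ<p)) (spot-tailStreet-gap s t (suc g) m 0 z<s)
    occ′ : spot st′ pₛ ≡ just (s + 0)
    occ′ = trans (proj₂ filled pₛ (>⇒≢ p<pₛ)) occ
    s<c : s + 0 < c
    s<c = <-≤-trans (+-monoʳ-< s 0<m) (m≤m+n (s + m) t)

  tailStreet-past-gap-rejected : ∀ s t g m r →
    completions (place (s + m + t) (s + t + suc g + r) (tailStreet s t (suc g) m)) (suc (s + m + t)) g ≡ 0
  tailStreet-past-gap-rejected s t g m r
    rewrite place-tailStreet-past-gap (s + m + t) s t (suc g) m r =
    completions-rejected st (suc (s + m + t)) g λ ps len →
      rejects-too-few-cars avoided st (suc (s + m + t)) ps (subst (_< emptySpots st) (sym len) few)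
    where
    st : Street
    st = tailStreet s t (suc g) m
    few : g < emptySpots st
    few rewrite emptySpots-block-++ 0 s (block (s + m) t ++ empties (suc g) ++ block s m)
              | emptySpots-block-++ (s + m) t (empties (suc g) ++ block s m)
              | emptySpots-empties-++ (suc g) (block s m) | emptySpots-full (block s m) (isFull-block s m)
              | +-identityʳ g = ≤-refl

  completions-tailStreet : ∀ g s t m → 0 < m → n ≡ s + t + g + m →
                          completions (tailStreet s t g m) (s + m + t) g * (s + t) ! ≡ (s + t + g) !
  completions-tailStreet zero s t m 0<m _ = begin
    completions (goodStreet s t m) (s + m + t) 0 * (s + t) !
      ≡⟨ cong (_* (s + t) !) (completions-done (goodStreet s t m) (s + m + t) (goodStreet-accepted s t m)) ⟩
    1 * (s + t) !
      ≡⟨ *-identityˡ _ ⟩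
    (s + t) !
      ≡⟨ cong _! (+-identityʳ (s + t)) ⟨
    (s + t + 0) !
      ∎
    where open ≡-Reasoning
  completions-tailStreet (suc g) s t m 0<m n≡ = begin
    completions st c (suc g) * (s + t) !
      ≡⟨ cong (_* (s + t) !) (completions-suc st c g) ⟩
    ∑< n h * (s + t) !
      ≡⟨ cong (λ k → ∑< k h * (s + t) !) n≡′ ⟩
    ∑< (0 + suc (s + t) + (g + m)) h * (s + t) !
      ≡⟨ cong (_* (s + t) !) (∑<-ranges 0 (suc (s + t)) (g + m) K (λ _ ()) front rest) ⟩
    suc (s + t) * K * (s + t) !
      ≡⟨ [1+a]*k*a!≡k*[1+a]! (s + t) K ⟩
    K * suc (s + t) !
      ≡⟨ cong₂ (λ c′ x → completions (tailStreet s (suc t) g m) c′ g * x !) (+-suc (s + m) t) (+-suc s t) ⟨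
    completions (tailStreet s (suc t) g m) (s + m + suc t) g * (s + suc t) !
      ≡⟨ completions-tailStreet g s (suc t) m 0<m (trans n≡ (solve (s ∷ t ∷ g ∷ m ∷ []))) ⟩
    (s + suc t + g) !
      ≡⟨ cong _! shift ⟩
    (s + t + suc g) !
      ∎
    where
    open ≡-Reasoning
    c K : ℕ
    c = s + m + t
    K = completions (tailStreet s (suc t) g m) (suc c) g
    st : Street
    st = tailStreet s t (suc g) m
    h : ℕ → ℕ
    h p = completions (place c p st) (suc c) g
    n≡′ : n ≡ 0 + suc (s + t) + (g + m)
    n≡′ = trans n≡ (solve (s ∷ t ∷ g ∷ m ∷ []))
    shift : s + suc t + g ≡ s + t + suc g
    shift = solve (s ∷ t ∷ g ∷ [])
    past-gap : ∀ r → suc (s + t) + (g + r) ≡ s + t + suc g + r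
    past-gap r = solve (s ∷ t ∷ g ∷ r ∷ [])
    front : ∀ i → i < suc (s + t) → h i ≡ K
    front i i≤ = cong (λ st′ → completions st′ (suc c) g) (place-tailStreet-front s t g m i (≤-pred i≤))
    rest : ∀ i → i < g + m → h (suc (s + t) + i) ≡ 0
    rest i i< with i <? g
    ... | yes i<g = trans (cong h (sym (+-suc (s + t) i))) (tailStreet-gap-rejected s t g m g i i<g 0<m)
    ... | no  i≮g with m≤n⇒∃[o]m+o≡n (≮⇒≥ i≮g)
    ...   | r , refl = trans (cong h (past-gap r)) (tailStreet-past-gap-rejected s t g m r)

  gapStreet-before-rejected : ∀ s g j e k p → p < s + suc g → 0 < j →
    completions (place (s + j) p (gapStreet s (suc g) j (suc e))) (suc (s + j)) k ≡ 0
  gapStreet-before-rejected s g j e k p p< 0<j = completions-rejected st′ (suc c) k λ ps _ →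
    rejects-213 st′ (suc c) ps q pₛ pₕ parked occ′ hole′ q<pₛ pₛ<pₕ pₕ< (+-monoʳ-< s 0<j) (n<1+n c)
    where
    c : ℕ
    c = s + j
    st st′ : Street
    st = gapStreet s (suc g) j (suc e)
    st′ = place c p st
    pₛ pₕ : ℕ
    pₛ = s + suc g + 0
    pₕ = s + suc g + j + 0
    len : length st ≡ s + suc g + j + suc e
    len = length-gapStreet s (suc g) j (suc e)
    p≤ : p ≤ s + g
    p≤ = ≤-pred (subst (p <_) (+-suc s g) p<)
    gap< : s + g < length st
    gap< = subst (s + g <_) (sym len)
                 (<-≤-trans (+-monoʳ-< s (n<1+n g)) (≤-trans (m≤m+n _ j) (m≤m+n _ (suc e))))
    open Landing (place-lands-by c p st (s + g) p≤ gap< (spot-gapStreet-gap s (suc g) j (suc e) g (n<1+n g)))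
    q<pₛ : q < pₛ
    q<pₛ = ≤-<-trans q≤e (subst (s + g <_) (sym (+-identityʳ _)) (+-monoʳ-< s (n<1+n g)))
    pₛ<pₕ : pₛ < pₕ
    pₛ<pₕ = +-monoˡ-< 0 (m<m+n (s + suc g) 0<j)
    pₕ< : pₕ < length st′
    pₕ< = subst (pₕ <_) (sym (trans (length-place c p st) len)) (+-monoʳ-< (s + suc g + j) z<s)
    occ′ : spot st′ pₛ ≡ just (s + 0)
    occ′ = trans (others pₛ (>⇒≢ q<pₛ)) (spot-gapStreet-block s (suc g) j (suc e) 0 0<j)
    hole′ : spot st′ pₕ ≡ nothing
    hole′ = trans (others pₕ (>⇒≢ (<-trans q<pₛ pₛ<pₕ))) (spot-gapStreet-tail s (suc g) j (suc e) 0)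

  gapStreet-after-rejected : ∀ s g j e k i → i < e → 0 < g → 0 < j →
    completions (place (s + j) (s + g + j + suc i) (gapStreet s g j (suc e))) (suc (s + j)) k ≡ 0
  gapStreet-after-rejected s g j e k i i<e 0<g 0<j = completions-rejected st′ (suc c) k λ ps _ →
    rejects-two-holes st′ (suc c) ps h₁ pₛ h₂ p hole₁ occ hole₂ (proj₁ filled) h₁<pₛ pₛ<h₂ h₂<p p<
                      (n<1+n c) s<c
    where
    c p h₁ pₛ h₂ : ℕ
    c = s + j
    p = s + g + j + suc i
    h₁ = s + 0
    pₛ = s + g + 0
    h₂ = s + g + j + 0
    st st′ : Street
    st = gapStreet s g j (suc e)
    st′ = place c p st
    h₁<pₛ : h₁ < pₛ
    h₁<pₛ = +-monoˡ-< 0 (m<m+n s 0<g)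
    pₛ<h₂ : pₛ < h₂
    pₛ<h₂ = +-monoˡ-< 0 (m<m+n (s + g) 0<j)
    h₂<p : h₂ < p
    h₂<p = +-monoʳ-< (s + g + j) z<s
    p<len : p < length st
    p<len = subst (p <_) (sym (length-gapStreet s g j (suc e))) (+-monoʳ-< (s + g + j) (s<s i<e))
    p< : p < length st′
    p< = subst (p <_) (sym (length-place c p st)) p<len
    filled : spot st′ p ≡ just c × (∀ i → i ≢ p → spot st′ i ≡ spot st i)
    filled = place-into-hole c p st (spot-gapStreet-tail s g j (suc e) (suc i)) p<len
    hole₁ : spot st′ h₁ ≡ nothing
    hole₁ = trans (proj₂ filled h₁ (<⇒≢ (<-trans h₁<pₛ (<-trans pₛ<h₂ h₂<p))))
                  (spot-gapStreet-gap s g j (suc e) 0 0<g)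
    occ : spot st′ pₛ ≡ just (s + 0)
    occ = trans (proj₂ filled pₛ (<⇒≢ (<-trans pₛ<h₂ h₂<p))) (spot-gapStreet-block s g j (suc e) 0 0<j)
    hole₂ : spot st′ h₂ ≡ nothing
    hole₂ = trans (proj₂ filled h₂ (<⇒≢ h₂<p)) (spot-gapStreet-tail s g j (suc e) 0)
    s<c : s + 0 < suc c
    s<c = s≤s (+-monoʳ-≤ s z≤n)

  completions-gapStreet : ∀ e s g j → 0 < g → 0 < j → n ≡ s + g + j + e →
                         completions (gapStreet s g j e) (s + j) (g + e) * (j ! * s !) ≡ (j + e) ! * (s + g) !
  completions-gapStreet zero s g j 0<g 0<j n≡ = begin
    completions (gapStreet s g j 0) (s + j) (g + 0) * (j ! * s !)
      ≡⟨ cong₂ (λ st k → completions st (s + j) k * (j ! * s !)) street (+-identityʳ g) ⟩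
    completions (tailStreet s 0 g j) (s + j) g * (j ! * s !)
      ≡⟨ cong (λ c → completions (tailStreet s 0 g j) c g * (j ! * s !)) (+-identityʳ (s + j)) ⟨
    N * (j ! * s !)
      ≡⟨ *-left-comm N (j !) (s !) ⟩
    j ! * (N * s !)
      ≡⟨ cong (λ x → j ! * (N * x !)) (+-identityʳ s) ⟨
    j ! * (N * (s + 0) !)
      ≡⟨ cong (j ! *_) (completions-tailStreet g s 0 j 0<j (trans n≡ (solve (s ∷ g ∷ j ∷ [])))) ⟩
    j ! * (s + 0 + g) !
      ≡⟨ cong₂ (λ a b → a ! * (b + g) !) (sym (+-identityʳ j)) (+-identityʳ s) ⟩
    (j + 0) ! * (s + g) !  ∎
    where
    open ≡-Reasoning
    N : ℕ
    N = completions (tailStreet s 0 g j) (s + j + 0) g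
    street : gapStreet s g j 0 ≡ tailStreet s 0 g j
    street = cong (λ st → block 0 s ++ empties g ++ st) (++-identityʳ (block s j))
  completions-gapStreet (suc e) s (suc g) j 0<g 0<j n≡ = begin
    completions st c (suc g + suc e) * (j ! * s !)
      ≡⟨ cong (λ k → completions st c (suc k) * (j ! * s !)) (+-suc g e) ⟩
    completions st c (suc (suc g + e)) * (j ! * s !)
      ≡⟨ cong (_* (j ! * s !)) (completions-suc st c (suc g + e)) ⟩
    ∑< n h * (j ! * s !)
      ≡⟨ cong (λ k → ∑< k h * (j ! * s !)) n≡′ ⟩
    ∑< (s + suc g + suc j + e) h * (j ! * s !)
      ≡⟨ cong (_* (j ! * s !)) (∑<-ranges (s + suc g) (suc j) e K before inside after) ⟩
    suc j * K * (j ! * s !)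
      ≡⟨ *-assoc (suc j * K) (j !) (s !) ⟨
    suc j * K * j ! * s !
      ≡⟨ cong (_* s !) ([1+a]*k*a!≡k*[1+a]! j K) ⟩
    K * suc j ! * s !
      ≡⟨ *-assoc K (suc j !) (s !) ⟩
    K * (suc j ! * s !)
      ≡⟨ cong (λ c′ → completions (gapStreet s (suc g) (suc j) e) c′ (suc g + e) * (suc j ! * s !)) (+-suc s j) ⟨
    completions (gapStreet s (suc g) (suc j) e) (s + suc j) (suc g + e) * (suc j ! * s !)
      ≡⟨ completions-gapStreet e s (suc g) (suc j) 0<g z<s (trans n≡ (solve (s ∷ g ∷ j ∷ e ∷ []))) ⟩
    (suc j + e) ! * (s + suc g) !
      ≡⟨ cong (λ x → x ! * (s + suc g) !) (+-suc j e) ⟨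
    (j + suc e) ! * (s + suc g) !
      ∎
    where
    open ≡-Reasoning
    c : ℕ
    c = s + j
    st : Street
    st = gapStreet s (suc g) j (suc e)
    h : ℕ → ℕ
    h p = completions (place c p st) (suc c) (suc g + e)
    K : ℕ
    K = completions (gapStreet s (suc g) (suc j) e) (suc c) (suc g + e)
    n≡′ : n ≡ s + suc g + suc j + e
    n≡′ = trans n≡ (solve (s ∷ g ∷ j ∷ e ∷ []))
    before : ∀ p → p < s + suc g → h p ≡ 0
    before p p< = gapStreet-before-rejected s g j e (suc g + e) p p< 0<j
    inside : ∀ i → i < suc j → h (s + suc g + i) ≡ K
    inside i i≤j =
      cong (λ st′ → completions st′ (suc c) (suc g + e)) (place-gapStreet-block s (suc g) j e i (≤-pred i≤j))
    into-tail : ∀ i → s + suc g + suc j + i ≡ s + suc g + j + suc i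
    into-tail i = solve (s ∷ g ∷ j ∷ i ∷ [])
    after : ∀ i → i < e → h (s + suc g + suc j + i) ≡ 0
    after i i<e = trans (cong h (into-tail i)) (gapStreet-after-rejected s (suc g) j e (suc g + e) i i<e 0<g 0<j)

  prefixStreet-gap-term : ∀ c r q e → suc q + e ≡ r → n ≡ c + suc r →
    completions (place c (suc c + q) (prefixStreet c (suc r))) (suc c) r * c ! ≡ (c + suc q) ! * (r ∸ q) !
  prefixStreet-gap-term c _ q e refl n≡ = begin
    completions (place c (suc c + q) (prefixStreet c (suc (suc q + e)))) (suc c) (suc q + e) * c !
      ≡⟨ cong (λ st → completions st (suc c) (suc q + e) * c !) (place-prefixStreet-gap c q e) ⟩
    completions (gapStreet c (suc q) 1 e) (suc c) (suc q + e) * c !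
      ≡⟨ cong₂ (λ c′ x → completions (gapStreet c (suc q) 1 e) c′ (suc q + e) * x) (+-comm c 1) (*-identityˡ (c !)) ⟨
    completions (gapStreet c (suc q) 1 e) (c + 1) (suc q + e) * (1 ! * c !)
      ≡⟨ completions-gapStreet e c (suc q) 1 z<s z<s (trans n≡ (solve (c ∷ q ∷ e ∷ []))) ⟩
    (1 + e) ! * (c + suc q) !
      ≡⟨ *-comm (suc e !) _ ⟩
    (c + suc q) ! * suc e !
      ≡⟨ cong (λ x → (c + suc q) ! * x !) (trans (cong (_∸ q) (sym (+-suc q e))) (m+n∸m≡n q (suc e))) ⟨
    (c + suc q) ! * (suc q + e ∸ q) !
      ∎
    where open ≡-Reasoning

  completions-prefixStreet : ∀ r c → n ≡ c + r → completions (prefixStreet c r) c r * c ! ≡ n ! + surplus c r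
  completions-prefixStreet zero c n≡ = begin
    completions (goodStreet c 0 0) c 0 * c !
      ≡⟨ cong (_* c !) (completions-done (goodStreet c 0 0) c (goodStreet-accepted c 0 0)) ⟩
    1 * c !
      ≡⟨ *-identityˡ (c !) ⟩
    c !
      ≡⟨ cong _! (trans n≡ (+-identityʳ c)) ⟨
    n !
      ≡⟨ +-identityʳ (n !) ⟨
    n ! + surplus c 0
      ∎
    where open ≡-Reasoning
  completions-prefixStreet (suc r) c n≡ = begin
    completions st c (suc r) * c !
      ≡⟨ cong (_* c !) (completions-suc st c r) ⟩
    ∑< n h * c !
      ≡⟨ cong (λ k → ∑< k h * c !) (trans n≡ (+-suc c r)) ⟩
    ∑< (suc c + r) h * c !
      ≡⟨ cong (_* c !) (∑<-+ (suc c) r h) ⟩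
    (∑< (suc c) h + ∑< r (h ∘ (suc c +_))) * c !
      ≡⟨ *-distribʳ-+ (c !) (∑< (suc c) h) _ ⟩
    ∑< (suc c) h * c ! + ∑< r (h ∘ (suc c +_)) * c !
      ≡⟨ cong₂ _+_ (cong (_* c !) (∑<-const (suc c) K front)) (∑<-distribʳ-* r (h ∘ (suc c +_)) (c !)) ⟩
    suc c * K * c ! + ∑< r (λ q → h (suc c + q) * c !)
      ≡⟨ cong₂ _+_ ([1+a]*k*a!≡k*[1+a]! c K) (∑<-cong r gap-term) ⟩
    K * suc c ! + G
      ≡⟨ cong (_+ G) (completions-prefixStreet r (suc c) (trans n≡ (+-suc c r))) ⟩
    n ! + surplus (suc c) r + G
      ≡⟨ +-assoc (n !) _ G ⟩
    n ! + (surplus (suc c) r + G)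
      ≡⟨ cong (n ! +_) (trans (+-comm _ G) (sym (surplus-suc c r))) ⟩
    n ! + surplus c (suc r)
      ∎
    where
    open ≡-Reasoning
    st : Street
    st = prefixStreet c (suc r)
    h : ℕ → ℕ
    h p = completions (place c p st) (suc c) r
    K G : ℕ
    K = completions (prefixStreet (suc c) r) (suc c) r
    G = ∑< r (λ q → (c + suc q) ! * (r ∸ q) !)
    front : ∀ p → p < suc c → h p ≡ K
    front p p≤c = cong (λ st′ → completions st′ (suc c) r) (place-prefixStreet-front c r p (≤-pred p≤c))
    gap-term : ∀ q → q < r → h (suc c + q) * c ! ≡ (c + suc q) ! * (r ∸ q) !
    gap-term q q<r = prefixStreet-gap-term c r q (proj₁ split) (proj₂ split) n≡
      where
      split : ∃ λ e → suc q + e ≡ r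
      split = m≤n⇒∃[o]m+o≡n q<r

pk≡n!+surplus : ∀ n → pk n avoided ≡ n ! + surplus 0 n
pk≡n!+surplus n = begin
  pk n avoided                              ≡⟨ pk≡completions n avoided ⟩
  completions (prefixStreet 0 n) 0 n        ≡⟨ *-identityʳ _ ⟨
  completions (prefixStreet 0 n) 0 n * 0 !  ≡⟨ completions-prefixStreet n 0 refl ⟩
  n ! + surplus 0 n                         ∎
  where
  open ≡-Reasoning
  open Completions avoided n using (completions)
  open Counting n using (completions-prefixStreet)

fromℚᵘ-homo-+ : ∀ p q → fromℚᵘ (p ℚᵘ.+ q) ≡ fromℚᵘ p ℚ.+ fromℚᵘ q
fromℚᵘ-homo-+ p q = toℚᵘ-injective (ℚᵘ.≃-trans (toℚᵘ-fromℚᵘ (p ℚᵘ.+ q))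
  (ℚᵘ.≃-trans (ℚᵘ.+-cong (ℚᵘ.≃-sym (toℚᵘ-fromℚᵘ p)) (ℚᵘ.≃-sym (toℚᵘ-fromℚᵘ q)))
              (ℚᵘ.≃-sym (toℚᵘ-homo-+ (fromℚᵘ p) (fromℚᵘ q)))))

fromℚᵘ-homo-* : ∀ p q → fromℚᵘ (p ℚᵘ.* q) ≡ fromℚᵘ p ℚ.* fromℚᵘ q
fromℚᵘ-homo-* p q = toℚᵘ-injective (ℚᵘ.≃-trans (toℚᵘ-fromℚᵘ (p ℚᵘ.* q))
  (ℚᵘ.≃-trans (ℚᵘ.*-cong (ℚᵘ.≃-sym (toℚᵘ-fromℚᵘ p)) (ℚᵘ.≃-sym (toℚᵘ-fromℚᵘ q)))
              (ℚᵘ.≃-sym (toℚᵘ-homo-* (fromℚᵘ p) (fromℚᵘ q)))))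

-- fromℕℚ m and fracℚ k (suc d) are by definition fromℚᵘ (mkℚᵘ (+ m) 0) and fromℚᵘ (mkℚᵘ (+ k) d),
-- so identities between them reduce to cross-multiplication in ℚᵘ.
fromℕℚ-+ : ∀ a b → fromℕℚ (a + b) ≡ fromℕℚ a ℚ.+ fromℕℚ b
fromℕℚ-+ a b = trans (fromℚᵘ-cong {mkℚᵘ (ℤ.+ (a + b)) 0} {â ℚᵘ.+ b̂} (*≡* eq)) (fromℚᵘ-homo-+ â b̂)
  where
  â b̂ : ℚᵘ.ℚᵘ
  â = mkℚᵘ (ℤ.+ a) 0
  b̂ = mkℚᵘ (ℤ.+ b) 0
  eq : ℤ.+ (a + b) ℤ.* ℤ.+ 1 ≡ (ℤ.+ a ℤ.* ℤ.+ 1 ℤ.+ ℤ.+ b ℤ.* ℤ.+ 1) ℤ.* ℤ.+ 1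
  eq rewrite ℤ.*-identityʳ (ℤ.+ (a + b)) | ℤ.*-identityʳ (ℤ.+ a) | ℤ.*-identityʳ (ℤ.+ b)
           | ℤ.*-identityʳ (ℤ.+ a ℤ.+ ℤ.+ b) = ℤ.pos-+ a b

fromℕℚ-*-fracℚ : ∀ a k b d → a * k ≡ b * suc d → fromℕℚ a ℚ.* fracℚ k (suc d) ≡ fromℕℚ b
fromℕℚ-*-fracℚ a k b d ak≡bd =
  trans (sym (fromℚᵘ-homo-* â k̂)) (fromℚᵘ-cong {â ℚᵘ.* k̂} {mkℚᵘ (ℤ.+ b) 0} (*≡* eq))
  where
  â k̂ : ℚᵘ.ℚᵘ
  â = mkℚᵘ (ℤ.+ a) 0
  k̂ = mkℚᵘ (ℤ.+ k) d
  eq : (ℤ.+ a ℤ.* ℤ.+ k) ℤ.* ℤ.+ 1 ≡ ℤ.+ b ℤ.* ℤ.+ suc (d + 0)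
  eq rewrite ℤ.*-identityʳ (ℤ.+ a ℤ.* ℤ.+ k) | +-identityʳ d =
    trans (sym (ℤ.pos-* a k)) (trans (cong ℤ.+_ ak≡bd) (ℤ.pos-* b (suc d)))

C*k!*[n∸k]!≡n! : ∀ n k → k ≤ n → (n C k) * (k ! * (n ∸ k) !) ≡ n !
C*k!*[n∸k]!≡n! n k k≤n =
  trans (cong (_* (k ! * (n ∸ k) !)) (nCk≡n!/k![n-k]! k≤n)) (m/n*n≡m {{_!*_!≢0 k (n ∸ k)}} (k![n∸k]!∣n! k≤n))

fromℕℚ-∑< : ∀ L (f : ℕ → ℕ) (g : ℕ → ℚ) x → (∀ i → i < L → x ℚ.* g i ≡ fromℕℚ (f i)) →
            fromℕℚ (∑< L f) ≡ x ℚ.* foldr ℚ._+_ 0ℚ (applyUpTo g L)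
fromℕℚ-∑< zero    f g x _     = sym (ℚ.*-zeroʳ x)
fromℕℚ-∑< (suc L) f g x terms = begin
  fromℕℚ (f 0 + ∑< L (f ∘ suc))
    ≡⟨ fromℕℚ-+ (f 0) _ ⟩
  fromℕℚ (f 0) ℚ.+ fromℕℚ (∑< L (f ∘ suc))
    ≡⟨ cong₂ ℚ._+_ (sym (terms 0 z<s)) (fromℕℚ-∑< L (f ∘ suc) (g ∘ suc) x (λ i i<L → terms (suc i) (s<s i<L))) ⟩
  x ℚ.* g 0 ℚ.+ x ℚ.* foldr ℚ._+_ 0ℚ (applyUpTo (g ∘ suc) L)
    ≡⟨ ℚ.*-distribˡ-+ x (g 0) _ ⟨
  x ℚ.* foldr ℚ._+_ 0ℚ (applyUpTo g (suc L))
    ∎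
  where open ≡-Reasoning

n!*k/nCk : ∀ r i → i < r → fromℕℚ (suc r !) ℚ.* fracℚ (suc i) (suc r C suc i) ≡ fromℕℚ (suc i * (suc i ! * (r ∸ i) !))
n!*k/nCk r i i<r with suc r C suc i | C*k!*[n∸k]!≡n! (suc r) (suc i) (s≤s (<⇒≤ i<r))
... | zero  | 0≡n! = ⊥-elim (≢-nonZero⁻¹ (suc r !) {{_!≢0 (suc r)}} (sym 0≡n!))
... | suc d | C*X≡n! = fromℕℚ-*-fracℚ (suc r !) (suc i) (suc i * X) d (begin
  suc r ! * suc i      ≡⟨ cong (_* suc i) C*X≡n! ⟨
  suc d * X * suc i    ≡⟨ *-comm (suc d * X) (suc i) ⟩
  suc i * (suc d * X)  ≡⟨ *-left-comm (suc i) (suc d) X ⟩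
  suc d * (suc i * X)  ≡⟨ *-comm (suc d) (suc i * X) ⟩
  suc i * X * suc d    ∎)
  where
  open ≡-Reasoning
  X : ℕ
  X = suc i ! * (r ∸ i) !

mainTheorem15 : (n : ℕ) → 1 Data.Nat.≤ n →
    fromℕℚ (pk n ((2 ∷ 1 ∷ 3 ∷ []) ∷ (3 ∷ 2 ∷ 1 ∷ []) ∷ []))
      ≡ fromℕℚ (n !) ℚ.+ fromℕℚ (n !) ℚ.* sumTerm n
mainTheorem15 (suc r) _ = begin
  fromℕℚ (pk (suc r) avoided)                       ≡⟨ cong fromℕℚ (pk≡n!+surplus (suc r)) ⟩
  fromℕℚ (n! + surplus 0 (suc r))                   ≡⟨ fromℕℚ-+ n! _ ⟩
  fromℕℚ n! ℚ.+ fromℕℚ (surplus 0 (suc r))          ≡⟨ cong (fromℕℚ n! ℚ.+_) (fromℕℚ-∑< r _ _ (fromℕℚ n!) (n!*k/nCk r)) ⟩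
  fromℕℚ n! ℚ.+ fromℕℚ n! ℚ.* sumTerm (suc r)       ∎
  where
  open ≡-Reasoning
  n! : ℕ
  n! = suc r !
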